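{- For every composition $\alpha$ and every positive integer $n$, the polynomial $\mathcal L_\alpha(x_1,\dots,x_n;t)$ is quasisymmetric in $x_1,\dots,x_n$; that is, for any composition $(a_1,\dots,a_k)$ and any two sequences $1\le i_1<\dots<i_k\le n$ and $1\le j_1<\dots<j_k\le n$, the coefficients of $x_{i_1}^{a_1}\cdots x_{i_k}^{a_k}$ and of $x_{j_1}^{a_1}\cdots x_{j_k}^{a_k}$ in $\mathcal L_\alpha$ are equal (as elements of $\mathbb Z[t]$).
   Context: A weak composition is a finite sequence $\gamma=(\gamma_1,\dots,\gamma_n)$ of nonnegative integers; a composition has all parts positive; $\alpha(\gamma)$ is obtained from $\gamma$ by deleting zero parts. Fillings. The augmented diagram of $\gamma=(\gamma_1,\dots,\gamma_n)$ has cells $(i,j)$, $1\le i\le n$ (row, from top), $0\le j\le\gamma_i$ (column); column $0$ is the basement, and here basement cell $(i,0)$ contains $b_i=i$. A filling $\tau$ assigns positive integers to the non-basement cells; for a non-basement cell $s$, $\mathrm{West}(s)$ is the cell immediately to its left (possibly a basement cell). Cells $(i,j),(i',j')$ attack if $j=j'$, or $j=j'+1$ and $i>i'$; $\tau$ is non-attacking if distinct attacking cells (basement included) have distinct entries. For a non-basement cell $s$, $\mathrm{leg}(s)$ is the number of cells of its row to the right of $s$; $\mathrm{maj}(\tau,\gamma)$ is the sum of $\mathrm{leg}(s)+1$ over all non-basement cells $s$ with $\tau(\mathrm{West}(s))<\tau(s)$. When comparing entries in a triple, of two equal entries the one appearing first when read top to bottom, right to left counts as smaller. A type A triple is $c=(i,k-1)$,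 $a=(i,k)$, $b=(j,k)$ with $i<j$, $k\ge1$, $\gamma_i\ge\gamma_j$; it is an inversion triple if in increasing order the entries are $a<c<b$, $c<b<a$ or $b<a<c$. A type B triple is $a=(i,k)$, $b=(j,k)$, $c=(j,k+1)$ with $i<j$, $k\ge0$, $\gamma_j>\gamma_i$; it is an inversion triple if in increasing order the entries are $a<c<b$, $c<b<a$ or $b<a<c$. $\mathrm{coinv}(\tau,\gamma)$ is the number of type A and type B triples (basement cells allowed) that are not inversion triples. $x^\tau=\prod_i x_i^{w_i}$ where $w_i$ is the number of non-basement cells with entry $i$. Definition: for a composition $\alpha$, $$\mathcal L_\alpha(x_1,\dots,x_n;t)=\sum_{\gamma}\ \sum_{\tau} x^\tau\, t^{\mathrm{coinv}(\tau,\gamma)}\prod_{s:\ \tau(s)\ne\tau(\mathrm{West}(s))}(1-t),$$ where $\gamma$ runs over weak compositions with $n$ parts and $\alpha(\gamma)=\alpha$, $\tau$ runs over non-attacking fillings of $\gamma$ with basement $b_i=i$ and $\mathrm{maj}(\tau,\gamma)=0$, and the product is over non-basement cells $s$ of $\gamma$. -}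

module Defs where

open import Data.Nat using (ℕ; zero; suc; _+_; _∸_; _≡ᵇ_; _<ᵇ_; _≤ᵇ_)
open import Data.Bool using (Bool; true; false; _∧_; _∨_; not; if_then_else_)
open import Data.List using (List; []; _∷_; map; length; upTo; concatMap; filterᵇ; foldr)
open import Data.Nat.ListAction using (sum)
open import Data.Bool.ListAction using (and)

all : {A : Set} → (A → Bool) → List A → Bool
all p xs = and (map p xs)
open import Data.Maybe using (Maybe; just; nothing; fromMaybe; _>>=_)
open import Data.Product using (_×_; _,_)
open import Data.Integer as ℤ using (ℤ)

-- Polynomials in t with integer coefficients, as coefficient lists
-- (constant term first).  Equality in ℤ[t] is coefficientwise: coeffP.

Poly : Set
Poly = List ℤ

_⊕_ : Poly → Poly → Poly
[] ⊕ q = q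
(a ∷ p) ⊕ [] = a ∷ p
(a ∷ p) ⊕ (b ∷ q) = (a ℤ.+ b) ∷ (p ⊕ q)

scaleP : ℤ → Poly → Poly
scaleP c = map (c ℤ.*_)

_⊗_ : Poly → Poly → Poly
[] ⊗ q = []
(a ∷ p) ⊗ q = scaleP a q ⊕ (ℤ.0ℤ ∷ (p ⊗ q))

tPow : ℕ → Poly
tPow zero = ℤ.1ℤ ∷ []
tPow (suc k) = ℤ.0ℤ ∷ tPow k

oneMinusTPow : ℕ → Poly
oneMinusTPow zero = ℤ.1ℤ ∷ []
oneMinusTPow (suc k) = (ℤ.1ℤ ∷ ℤ.-1ℤ ∷ []) ⊗ oneMinusTPow k

coeffP : Poly → ℕ → ℤ
coeffP [] m = ℤ.0ℤ
coeffP (a ∷ p) zero = a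
coeffP (a ∷ p) (suc m) = coeffP p m

sumP : List Poly → Poly
sumP = foldr _⊕_ []

-- Fillings.  A filling of a weak composition γ = (γ₁,…,γₙ) is a list of
-- n rows; row i (1-indexed, from the top) is the list of the γᵢ entries
-- in columns 1,…,γᵢ.  So γᵢ is the length of row i.

Filling : Set
Filling = List (List ℕ)

nth : {A : Set} → List A → ℕ → Maybe A
nth [] _ = nothing
nth (x ∷ xs) zero = just x
nth (x ∷ xs) (suc k) = nth xs k

rowLen : Filling → ℕ → ℕ
rowLen F zero = 0
rowLen F (suc i) = fromMaybe 0 (nth F i >>= λ r → just (length r))

-- entry of cell (i , j), basement (i , 0) contains i
entry : Filling → ℕ → ℕ → Maybe ℕ
entry F zero j = nothing
entry F (suc i) zero = if suc i ≤ᵇ length F then just (suc i) else nothing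
entry F (suc i) (suc j) = nth F i >>= λ r → nth r j

Cell : Set
Cell = ℕ × ℕ

val : Filling → Cell → ℕ
val F (i , j) = fromMaybe 0 (entry F i j)

rows : Filling → List ℕ
rows F = map suc (upTo (length F))

cells : Filling → List Cell
cells F = concatMap (λ i → map (λ j → (i , j)) (map suc (upTo (rowLen F i)))) (rows F)

-- cells of the augmented diagram (basement included)
augCells : Filling → List Cell
augCells F = concatMap (λ i → map (λ j → (i , j)) (upTo (suc (rowLen F i)))) (rows F)

count : {A : Set} → (A → Bool) → List A → ℕ
count p xs = length (filterᵇ p xs)

sameCell : Cell → Cell → Bool
sameCell (i , j) (i' , j') = (i ≡ᵇ i') ∧ (j ≡ᵇ j')

-- (i,j) and (i',j') attack if j = j', or j = j' + 1 and i > i'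
-- (checked over all ordered pairs, so both orientations are covered)
attacks : Cell → Cell → Bool
attacks (i , j) (i' , j') = (j ≡ᵇ j') ∨ ((j ≡ᵇ suc j') ∧ (i' <ᵇ i))

nonAttacking : Filling → Bool
nonAttacking F =
  all (λ c → all (λ d → not (not (sameCell c d) ∧ attacks c d) ∨ not (val F c ≡ᵇ val F d))
                 (augCells F))
      (augCells F)

west : Cell → Cell
west (i , j) = (i , j ∸ 1)

leg : Filling → Cell → ℕ
leg F (i , j) = rowLen F i ∸ j

maj : Filling → ℕ
maj F = sum (map (λ s → if val F (west s) <ᵇ val F s then leg F s + 1 else 0) (cells F))

-- reading order: top to bottom, and right to left within a row
precedes : Cell → Cell → Bool
precedes (i , j) (i' , j') = (i <ᵇ i') ∨ ((i ≡ᵇ i') ∧ (j' <ᵇ j))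

-- strict comparison of entries with the tie-breaking convention
lt : Filling → Cell → Cell → Bool
lt F c d = (val F c <ᵇ val F d) ∨ ((val F c ≡ᵇ val F d) ∧ precedes c d)

isInversion : Filling → Cell × Cell × Cell → Bool
isInversion F (a , b , c) =
  (lt F a c ∧ lt F c b) ∨ (lt F c b ∧ lt F b a) ∨ (lt F b a ∧ lt F a c)

pairsLt : Filling → List (ℕ × ℕ)
pairsLt F = concatMap (λ i → map (λ j → (i , j)) (filterᵇ (i <ᵇ_) (rows F))) (rows F)

-- type A: a = (i,k), b = (j,k), c = (i,k-1), i < j, k ≥ 1, γᵢ ≥ γⱼ,
-- all three cells in the augmented diagram (i.e. 1 ≤ k ≤ γⱼ)
typeA : Filling → List (Cell × Cell × Cell)
typeA F = concatMap
  (λ { (i , j) → if rowLen F j ≤ᵇ rowLen F i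
        then map (λ k → ((i , k) , (j , k) , (i , k ∸ 1))) (map suc (upTo (rowLen F j)))
        else [] })
  (pairsLt F)

-- type B: a = (i,k), b = (j,k), c = (j,k+1), i < j, k ≥ 0, γⱼ > γᵢ,
-- all three cells in the augmented diagram (i.e. 0 ≤ k ≤ γᵢ)
typeB : Filling → List (Cell × Cell × Cell)
typeB F = concatMap
  (λ { (i , j) → if rowLen F i <ᵇ rowLen F j
        then map (λ k → ((i , k) , (j , k) , (j , suc k))) (upTo (suc (rowLen F i)))
        else [] })
  (pairsLt F)

coinv : Filling → ℕ
coinv F = count (λ tr → not (isInversion F tr)) (typeA F) + count (λ tr → not (isInversion F tr)) (typeB F)

nDiff : Filling → ℕ
nDiff F = count (λ s → not (val F s ≡ᵇ val F (west s))) (cells F)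

weight : Filling → ℕ → ℕ
weight F l = count (λ s → val F s ≡ᵇ l) (cells F)

listsOver : ℕ → List ℕ → List (List ℕ)
listsOver zero xs = [] ∷ []
listsOver (suc m) xs = concatMap (λ x → map (x ∷_) (listsOver m xs)) xs

eqListᵇ : List ℕ → List ℕ → Bool
eqListᵇ [] [] = true
eqListᵇ (x ∷ xs) (y ∷ ys) = (x ≡ᵇ y) ∧ eqListᵇ xs ys
eqListᵇ _ _ = false

delZeros : List ℕ → List ℕ
delZeros = filterᵇ (λ x → 0 <ᵇ x)

weakComps : ℕ → List ℕ → List (List ℕ)
weakComps n α = filterᵇ (λ γ → eqListᵇ (delZeros γ) α) (listsOver n (upTo (suc (sum α))))

fillingsOfShape : ℕ → List ℕ → List Filling
fillingsOfShape n [] = [] ∷ []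
fillingsOfShape n (g ∷ γ) =
  concatMap (λ r → map (r ∷_) (fillingsOfShape n γ)) (listsOver g (map suc (upTo n)))

admissible : ℕ → List ℕ → List Filling
admissible n α =
  filterᵇ (λ F → nonAttacking F ∧ (maj F ≡ᵇ 0))
          (concatMap (fillingsOfShape n) (weakComps n α))

contrib : Filling → Poly
contrib F = tPow (coinv F) ⊗ oneMinusTPow (nDiff F)

LCoeff : ℕ → List ℕ → (ℕ → ℕ) → Poly
LCoeff n α w =
  sumP (map contrib (filterᵇ (λ F → all (λ l → weight F l ≡ᵇ w l) (map suc (upTo n)))
                              (admissible n α)))

-- exponent vector of x_{i₁}^{a₁} ⋯ x_{i_k}^{a_k}
monoExp : List ℕ → List ℕ → ℕ → ℕ
monoExp (a ∷ as) (i ∷ is) l = (if i ≡ᵇ l then a else 0) + monoExp as is l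
monoExp _ _ l = 0

module Submission where

-- Write C(w) for the coefficient (in ℤ[t]) of the monomial x^w in L_α.  The
-- heart of the proof is the swap lemma: if l+1 ≤ n and w(l+1) = 0, then
-- C(w) = C(w ∘ sₗ), where sₗ is the transposition (l l+1).  It is proved by
-- the map σₗ on fillings (σ t below, with l = t+1) which exchanges rows l
-- and l+1 and exchanges the entries l and l+1.  In an admissible filling (non-attacking, maj = 0) the
-- cell (r,1) holds r; so a filling of weight w has an empty row l+1 and no
-- entry l+1, and on such fillings σₗ preserves non-attacking-ness, maj, coinv
-- and the number of cells differing from their west neighbour, while it turns
-- the weight w into w ∘ sₗ.  Since σₗ only swaps the zero part γ_{l+1} of the
-- shape with γₗ, α(γ) is unchanged, and reindexing the defining sum by σₗ
-- gives the swap lemma.  Quasisymmetry then follows by applying the swap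
-- lemma repeatedly, moving the exponents of x_{i₁}^{a₁}⋯x_{i_k}^{a_k} to the
-- canonical positions 1,…,k.

open import Defs
open import Data.Nat using (ℕ; zero; suc; _+_; _∸_; _≡ᵇ_; _<ᵇ_; _≤ᵇ_; _<_; _≤_; z≤n; s≤s)
import Data.Nat.Properties as NP
open import Data.Bool using (Bool; true; false; _∧_; _∨_; not; if_then_else_; T)
import Data.Bool.Properties as BP
open import Data.List using (List; []; _∷_; map; length; upTo; concatMap; filterᵇ; _++_)
import Data.List.Properties as LP
open import Data.Nat.ListAction using (sum)
open import Data.Bool.ListAction using (and)
open import Data.Maybe using (just; nothing; fromMaybe)
import Data.Maybe as Maybe
open import Data.Product using (_×_; _,_; proj₁; proj₂)
open import Data.Sum using (inj₁; inj₂)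
open import Data.Empty using (⊥; ⊥-elim)
open import Data.Unit using (⊤; tt)
open import Data.Integer as ℤ using (ℤ)
import Data.Integer.Properties as ZP
open import Data.List.Relation.Unary.All as All using (All; []; _∷_)
import Data.List.Relation.Unary.All.Properties as AllP
open import Data.List.Relation.Unary.AllPairs using (AllPairs; []; _∷_)
open import Algebra.Structures using (IsCommutativeMonoid)
open import Relation.Nullary using (¬_; yes; no)
open import Relation.Binary.PropositionalEquality

T-ext : {a b : Bool} → (T a → T b) → (T b → T a) → a ≡ b
T-ext {false} {false} f g = refl
T-ext {false} {true} f g = ⊥-elim (g _)
T-ext {true} {false} f g = ⊥-elim (f _)
T-ext {true} {true} f g = refl

T⇒true : {a : Bool} → T a → a ≡ true
T⇒true {true} _ = refl

true⇒T : {a : Bool} → a ≡ true → T a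
true⇒T refl = _

¬T⇒false : {a : Bool} → ¬ T a → a ≡ false
¬T⇒false {false} _ = refl
¬T⇒false {true} f = ⊥-elim (f _)

≡ᵇ-refl : ∀ x → (x ≡ᵇ x) ≡ true
≡ᵇ-refl zero = refl
≡ᵇ-refl (suc x) = ≡ᵇ-refl x

≢⇒≡ᵇ-false : ∀ {x y} → x ≢ y → (x ≡ᵇ y) ≡ false
≢⇒≡ᵇ-false {x} {y} x≢y = ¬T⇒false (λ h → x≢y (NP.≡ᵇ⇒≡ x y h))

n<ᵇ1+n : ∀ n → (n <ᵇ suc n) ≡ true
n<ᵇ1+n n = T⇒true (NP.<⇒<ᵇ (NP.n<1+n n))

1+n<ᵇn : ∀ n → (suc n <ᵇ n) ≡ false
1+n<ᵇn n = ¬T⇒false (λ h → NP.<-asym (NP.<ᵇ⇒< _ _ h) (NP.n<1+n n))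

n<ᵇn : ∀ n → (n <ᵇ n) ≡ false
n<ᵇn n = ¬T⇒false (λ h → NP.<-irrefl refl (NP.<ᵇ⇒< n n h))

transp : ℕ → ℕ → ℕ
transp p x = if x ≡ᵇ p then suc p else (if x ≡ᵇ suc p then p else x)

data Position (p x : ℕ) : Set where
  at-p : x ≡ p → Position p x
  at-1+p : x ≡ suc p → Position p x
  elsewhere : x ≢ p → x ≢ suc p → Position p x

position : ∀ p x → Position p x
position p x with x NP.≟ p | x NP.≟ suc p
... | yes e | _ = at-p e
... | no _ | yes e = at-1+p e
... | no e₁ | no e₂ = elsewhere e₁ e₂

transp-p : ∀ p → transp p p ≡ suc p
transp-p p rewrite ≡ᵇ-refl p = refl

transp-1+p : ∀ p → transp p (suc p) ≡ p
transp-1+p p rewrite ≢⇒≡ᵇ-false (NP.1+n≢n {p}) | ≡ᵇ-refl p = refl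

transp-elsewhere : ∀ {p x} → x ≢ p → x ≢ suc p → transp p x ≡ x
transp-elsewhere x≢p x≢1+p rewrite ≢⇒≡ᵇ-false x≢p | ≢⇒≡ᵇ-false x≢1+p = refl

transp-involutive : ∀ p x → transp p (transp p x) ≡ x
transp-involutive p x with position p x
... | at-p refl rewrite transp-p p = transp-1+p p
... | at-1+p refl rewrite transp-1+p p = transp-p p
... | elsewhere e₁ e₂ rewrite transp-elsewhere e₁ e₂ = transp-elsewhere e₁ e₂

-- Rows and entries are numbered from 1, so shifting commutes with sₚ.
transp-suc : ∀ p x → transp (suc p) (suc x) ≡ suc (transp p x)
transp-suc p x with position p x
... | at-p refl rewrite transp-p p = transp-p (suc p)
... | at-1+p refl rewrite transp-1+p p = transp-1+p (suc p)
... | elsewhere e₁ e₂ rewrite transp-elsewhere e₁ e₂ =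
  transp-elsewhere (λ e → e₁ (NP.suc-injective e)) (λ e → e₂ (NP.suc-injective e))

transp-≡ᵇ : ∀ p x y → (transp p x ≡ᵇ transp p y) ≡ (x ≡ᵇ y)
transp-≡ᵇ p x y = T-ext (λ h → NP.≡⇒≡ᵇ x y (injective (NP.≡ᵇ⇒≡ _ _ h)))
                        (λ h → NP.≡⇒≡ᵇ _ _ (cong (transp p) (NP.≡ᵇ⇒≡ x y h)))
  where
  injective : transp p x ≡ transp p y → x ≡ y
  injective e = trans (sym (transp-involutive p x)) (trans (cong (transp p) e) (transp-involutive p y))

NotAdjacentPair : ℕ → ℕ → ℕ → Set
NotAdjacentPair p x y = ¬ (x ≡ p × y ≡ suc p) × ¬ (x ≡ suc p × y ≡ p)

transp-<ᵇ : ∀ p x y → NotAdjacentPair p x y → (transp p x <ᵇ transp p y) ≡ (x <ᵇ y)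
transp-<ᵇ p x y (n₁ , n₂) =
  T-ext (λ h → NP.<⇒<ᵇ (reflect (NP.<ᵇ⇒< _ _ h))) (λ h → NP.<⇒<ᵇ (preserve (NP.<ᵇ⇒< _ _ h)))
  where
  preserve : x < y → transp p x < transp p y
  preserve x<y with position p x | position p y
  ... | at-p refl | at-p refl = ⊥-elim (NP.<-irrefl refl x<y)
  ... | at-p refl | at-1+p refl = ⊥-elim (n₁ (refl , refl))
  ... | at-p refl | elsewhere e₁ e₂ rewrite transp-p p | transp-elsewhere e₁ e₂ = NP.≤∧≢⇒< x<y (λ e → e₂ (sym e))
  ... | at-1+p refl | at-p refl = ⊥-elim (n₂ (refl , refl))
  ... | at-1+p refl | at-1+p refl = ⊥-elim (NP.<-irrefl refl x<y)
  ... | at-1+p refl | elsewhere e₁ e₂ rewrite transp-1+p p | transp-elsewhere e₁ e₂ = NP.<-trans (NP.n<1+n p) x<y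
  ... | elsewhere e₁ e₂ | at-p refl rewrite transp-p p | transp-elsewhere e₁ e₂ = NP.m<n⇒m<1+n x<y
  ... | elsewhere e₁ e₂ | at-1+p refl rewrite transp-1+p p | transp-elsewhere e₁ e₂ = NP.≤∧≢⇒< (NP.≤-pred x<y) e₁
  ... | elsewhere e₁ e₂ | elsewhere e₃ e₄ rewrite transp-elsewhere e₁ e₂ | transp-elsewhere e₃ e₄ = x<y
  reflect : transp p x < transp p y → x < y
  reflect h with position p x | position p y
  ... | at-p refl | at-p refl = ⊥-elim (NP.<-irrefl refl h)
  ... | at-p refl | at-1+p refl = ⊥-elim (n₁ (refl , refl))
  ... | at-p refl | elsewhere e₁ e₂ rewrite transp-p p | transp-elsewhere e₁ e₂ = NP.<-trans (NP.n<1+n p) h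
  ... | at-1+p refl | at-p refl = ⊥-elim (n₂ (refl , refl))
  ... | at-1+p refl | at-1+p refl = ⊥-elim (NP.<-irrefl refl h)
  ... | at-1+p refl | elsewhere e₁ e₂ rewrite transp-1+p p | transp-elsewhere e₁ e₂ = NP.≤∧≢⇒< h (λ e → e₂ (sym e))
  ... | elsewhere e₁ e₂ | at-p refl rewrite transp-p p | transp-elsewhere e₁ e₂ = NP.≤∧≢⇒< (NP.≤-pred h) e₁
  ... | elsewhere e₁ e₂ | at-1+p refl rewrite transp-1+p p | transp-elsewhere e₁ e₂ = NP.m<n⇒m<1+n h
  ... | elsewhere e₁ e₂ | elsewhere e₃ e₄ rewrite transp-elsewhere e₁ e₂ | transp-elsewhere e₃ e₄ = h

module BigOp {A : Set} {_⊙_ : A → A → A} {e : A}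
  (M : IsCommutativeMonoid _≡_ _⊙_ e) where

  open IsCommutativeMonoid M using (assoc; comm; identityˡ; identityʳ)

  ⨁ : {B : Set} → (B → A) → List B → A
  ⨁ g [] = e
  ⨁ g (x ∷ xs) = g x ⊙ ⨁ g xs

  ⨁-++ : {B : Set} (g : B → A) (xs ys : List B) → ⨁ g (xs ++ ys) ≡ ⨁ g xs ⊙ ⨁ g ys
  ⨁-++ g [] ys = sym (identityˡ _)
  ⨁-++ g (x ∷ xs) ys = trans (cong (g x ⊙_) (⨁-++ g xs ys)) (sym (assoc _ _ _))

  ⨁-map : {B C : Set} (g : C → A) (f : B → C) (xs : List B) → ⨁ g (map f xs) ≡ ⨁ (λ x → g (f x)) xs
  ⨁-map g f [] = refl
  ⨁-map g f (x ∷ xs) = cong (g (f x) ⊙_) (⨁-map g f xs)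

  ⨁-concatMap : {B C : Set} (g : C → A) (f : B → List C) (xs : List B) →
    ⨁ g (concatMap f xs) ≡ ⨁ (λ x → ⨁ g (f x)) xs
  ⨁-concatMap g f [] = refl
  ⨁-concatMap g f (x ∷ xs) =
    trans (⨁-++ g (f x) (concatMap f xs)) (cong (⨁ g (f x) ⊙_) (⨁-concatMap g f xs))

  ⨁-filter : {B : Set} (g : B → A) (p : B → Bool) (xs : List B) →
    ⨁ g (filterᵇ p xs) ≡ ⨁ (λ x → if p x then g x else e) xs
  ⨁-filter g p [] = refl
  ⨁-filter g p (x ∷ xs) with p x
  ... | true = cong (g x ⊙_) (⨁-filter g p xs)
  ... | false = trans (⨁-filter g p xs) (sym (identityˡ _))

  ⨁-cong : {B : Set} {g h : B → A} → (∀ x → g x ≡ h x) → (xs : List B) → ⨁ g xs ≡ ⨁ h xs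
  ⨁-cong eq [] = refl
  ⨁-cong eq (x ∷ xs) = cong₂ _⊙_ (eq x) (⨁-cong eq xs)

  ⨁-congAll : {B : Set} {P : B → Set} {g h : B → A} {xs : List B} →
    All P xs → (∀ x → P x → g x ≡ h x) → ⨁ g xs ≡ ⨁ h xs
  ⨁-congAll [] eq = refl
  ⨁-congAll (px ∷ pxs) eq = cong₂ _⊙_ (eq _ px) (⨁-congAll pxs eq)

  ⨁-unit : {B : Set} (xs : List B) → ⨁ (λ _ → e) xs ≡ e
  ⨁-unit [] = refl
  ⨁-unit (x ∷ xs) = trans (cong (e ⊙_) (⨁-unit xs)) (identityˡ e)

  ⨁-distrib : {B : Set} (g h : B → A) (xs : List B) → ⨁ (λ x → g x ⊙ h x) xs ≡ ⨁ g xs ⊙ ⨁ h xs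
  ⨁-distrib g h [] = sym (identityˡ e)
  ⨁-distrib g h (x ∷ xs) = begin
      (g x ⊙ h x) ⊙ ⨁ (λ x → g x ⊙ h x) xs
    ≡⟨ cong ((g x ⊙ h x) ⊙_) (⨁-distrib g h xs) ⟩
      (g x ⊙ h x) ⊙ (⨁ g xs ⊙ ⨁ h xs)
    ≡⟨ assoc _ _ _ ⟩
      g x ⊙ (h x ⊙ (⨁ g xs ⊙ ⨁ h xs))
    ≡⟨ cong (g x ⊙_) (sym (assoc _ _ _)) ⟩
      g x ⊙ ((h x ⊙ ⨁ g xs) ⊙ ⨁ h xs)
    ≡⟨ cong (λ z → g x ⊙ (z ⊙ ⨁ h xs)) (comm _ _) ⟩
      g x ⊙ ((⨁ g xs ⊙ h x) ⊙ ⨁ h xs)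
    ≡⟨ cong (g x ⊙_) (assoc _ _ _) ⟩
      g x ⊙ (⨁ g xs ⊙ (h x ⊙ ⨁ h xs))
    ≡⟨ sym (assoc _ _ _) ⟩
      (g x ⊙ ⨁ g xs) ⊙ (h x ⊙ ⨁ h xs)
    ∎ where open ≡-Reasoning

  ⨁-comm : {B C : Set} (g : B → C → A) (xs : List B) (ys : List C) →
    ⨁ (λ x → ⨁ (g x) ys) xs ≡ ⨁ (λ y → ⨁ (λ x → g x y) xs) ys
  ⨁-comm g [] ys = sym (⨁-unit ys)
  ⨁-comm g (x ∷ xs) ys =
    trans (cong (⨁ (g x) ys ⊙_) (⨁-comm g xs ys)) (sym (⨁-distrib (g x) (λ y → ⨁ (λ x → g x y) xs) ys))

  ⨁< : ℕ → (ℕ → A) → A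
  ⨁< k g = ⨁ g (upTo k)

  ⨁<-suc : (k : ℕ) (g : ℕ → A) → ⨁< (suc k) g ≡ ⨁< k g ⊙ g k
  ⨁<-suc k g = begin
      ⨁ g (upTo (suc k))
    ≡⟨ cong (⨁ g) (sym (LP.upTo-∷ʳ k)) ⟩
      ⨁ g (upTo k ++ (k ∷ []))
    ≡⟨ ⨁-++ g (upTo k) (k ∷ []) ⟩
      ⨁< k g ⊙ (g k ⊙ e)
    ≡⟨ cong (⨁< k g ⊙_) (identityʳ (g k)) ⟩
      ⨁< k g ⊙ g k
    ∎ where open ≡-Reasoning

  ⨁<-cong : (k : ℕ) {g h : ℕ → A} → (∀ x → x < k → g x ≡ h x) → ⨁< k g ≡ ⨁< k h
  ⨁<-cong zero eq = refl
  ⨁<-cong (suc k) {g} {h} eq = begin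
      ⨁< (suc k) g ≡⟨ ⨁<-suc k g ⟩
      ⨁< k g ⊙ g k ≡⟨ cong₂ _⊙_ (⨁<-cong k (λ x x<k → eq x (NP.m<n⇒m<1+n x<k))) (eq k NP.≤-refl) ⟩
      ⨁< k h ⊙ h k ≡⟨ sym (⨁<-suc k h) ⟩
      ⨁< (suc k) h ∎ where open ≡-Reasoning

  ⨁<-transp : (k p : ℕ) (g : ℕ → A) → suc p < k → ⨁< k (λ x → g (transp p x)) ≡ ⨁< k g
  ⨁<-transp (suc k) p g (s≤s p+1≤k) with NP.m≤n⇒m<n∨m≡n p+1≤k
  ... | inj₁ p+1<k = begin
        ⨁< (suc k) (λ x → g (transp p x))
      ≡⟨ ⨁<-suc k _ ⟩
        ⨁< k (λ x → g (transp p x)) ⊙ g (transp p k)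
      ≡⟨ cong₂ _⊙_ (⨁<-transp k p g p+1<k) (cong g (transp-elsewhere k≢p k≢1+p)) ⟩
        ⨁< k g ⊙ g k
      ≡⟨ sym (⨁<-suc k g) ⟩
        ⨁< (suc k) g
      ∎ where
      open ≡-Reasoning
      k≢p : k ≢ p
      k≢p e = NP.<-irrefl (sym e) (NP.<-trans (NP.n<1+n p) p+1<k)
      k≢1+p : k ≢ suc p
      k≢1+p e = NP.<-irrefl (sym e) p+1<k
  ... | inj₂ refl = begin
        ⨁< (suc (suc p)) (λ x → g (transp p x))
      ≡⟨ trans (⨁<-suc (suc p) _) (cong (_⊙ g (transp p (suc p))) (⨁<-suc p _)) ⟩
        (⨁< p (λ x → g (transp p x)) ⊙ g (transp p p)) ⊙ g (transp p (suc p))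
      ≡⟨ cong₂ (λ a b → (a ⊙ g b) ⊙ g (transp p (suc p))) (⨁<-cong p below-p) (transp-p p) ⟩
        (⨁< p g ⊙ g (suc p)) ⊙ g (transp p (suc p))
      ≡⟨ cong (λ z → (⨁< p g ⊙ g (suc p)) ⊙ g z) (transp-1+p p) ⟩
        (⨁< p g ⊙ g (suc p)) ⊙ g p
      ≡⟨ trans (assoc _ _ _) (trans (cong (⨁< p g ⊙_) (comm _ _)) (sym (assoc _ _ _))) ⟩
        (⨁< p g ⊙ g p) ⊙ g (suc p)
      ≡⟨ sym (trans (⨁<-suc (suc p) g) (cong (_⊙ g (suc p)) (⨁<-suc p g))) ⟩
        ⨁< (suc (suc p)) g
      ∎ where
      open ≡-Reasoning
      below-p : ∀ x → x < p → g (transp p x) ≡ g x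
      below-p x x<p = cong g (transp-elsewhere (λ e → NP.<-irrefl e x<p)
                                                (λ e → NP.<-irrefl e (NP.<-trans x<p (NP.n<1+n p))))

  ⨁-rows-transp : (n p : ℕ) (g : ℕ → A) → suc p < n →
    ⨁ (λ j → g (transp (suc p) j)) (map suc (upTo n)) ≡ ⨁ g (map suc (upTo n))
  ⨁-rows-transp n p g p+1<n = begin
      ⨁ (λ j → g (transp (suc p) j)) (map suc (upTo n))
    ≡⟨ ⨁-map _ suc (upTo n) ⟩
      ⨁< n (λ x → g (transp (suc p) (suc x)))
    ≡⟨ ⨁-cong (λ x → cong g (transp-suc p x)) (upTo n) ⟩
      ⨁< n (λ x → g (suc (transp p x)))
    ≡⟨ ⨁<-transp n p (λ x → g (suc x)) p+1<n ⟩
      ⨁< n (λ x → g (suc x))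
    ≡⟨ sym (⨁-map _ suc (upTo n)) ⟩
      ⨁ g (map suc (upTo n))
    ∎ where open ≡-Reasoning

  module Conical (conical : ∀ x y → x ⊙ y ≡ e → x ≡ e × y ≡ e) where
    ⨁<-vanishing : (k : ℕ) (g : ℕ → A) → ⨁< k g ≡ e → ∀ x → x < k → g x ≡ e
    ⨁<-vanishing (suc k) g sum≡e x x<1+k rewrite ⨁<-suc k g with NP.m≤n⇒m<n∨m≡n (NP.≤-pred x<1+k)
    ... | inj₁ x<k = ⨁<-vanishing k g (proj₁ (conical _ _ sum≡e)) x x<k
    ... | inj₂ refl = proj₂ (conical _ _ sum≡e)

module ΣN = BigOp NP.+-0-isCommutativeMonoid
module ΣB = BigOp BP.∧-isCommutativeMonoid
module ΣZ = BigOp ZP.+-0-isCommutativeMonoid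

+-conical : ∀ x y → x + y ≡ 0 → x ≡ 0 × y ≡ 0
+-conical x y eq = NP.m+n≡0⇒m≡0 x eq , NP.m+n≡0⇒n≡0 x eq

∧-conical : ∀ x y → x ∧ y ≡ true → x ≡ true × y ≡ true
∧-conical true y eq = refl , eq

swapAdjacent : {A : Set} → ℕ → List A → List A
swapAdjacent zero (x ∷ y ∷ xs) = y ∷ x ∷ xs
swapAdjacent (suc p) (x ∷ xs) = x ∷ swapAdjacent p xs
swapAdjacent _ xs = xs

length-swapAdjacent : {A : Set} (p : ℕ) (xs : List A) → length (swapAdjacent p xs) ≡ length xs
length-swapAdjacent zero [] = refl
length-swapAdjacent zero (x ∷ []) = refl
length-swapAdjacent zero (x ∷ y ∷ xs) = refl
length-swapAdjacent (suc p) [] = refl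
length-swapAdjacent (suc p) (x ∷ xs) = cong suc (length-swapAdjacent p xs)

nth-swapAdjacent : {A : Set} (p : ℕ) (xs : List A) → suc p < length xs →
  ∀ i → nth (swapAdjacent p xs) i ≡ nth xs (transp p i)
nth-swapAdjacent zero (x ∷ []) (s≤s ()) i
nth-swapAdjacent zero (x ∷ y ∷ xs) _ zero = refl
nth-swapAdjacent zero (x ∷ y ∷ xs) _ (suc zero) = refl
nth-swapAdjacent zero (x ∷ y ∷ xs) _ (suc (suc i)) = refl
nth-swapAdjacent (suc p) (x ∷ xs) _ zero = refl
nth-swapAdjacent (suc p) (x ∷ xs) (s≤s p+1<len) (suc i) =
  trans (nth-swapAdjacent p xs p+1<len i) (cong (nth (x ∷ xs)) (sym (transp-suc p i)))

nth-map : {A B : Set} (f : A → B) (xs : List A) (i : ℕ) → nth (map f xs) i ≡ Maybe.map f (nth xs i)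
nth-map f [] i = refl
nth-map f (x ∷ xs) zero = refl
nth-map f (x ∷ xs) (suc i) = nth-map f xs i

val-basement : ∀ F i → val F (suc i , 0) ≡ (if suc i ≤ᵇ length F then suc i else 0)
val-basement F i with suc i ≤ᵇ length F
... | true = refl
... | false = refl

val-basement-inside : ∀ F r → 1 ≤ r → r ≤ length F → val F (r , 0) ≡ r
val-basement-inside F (suc r) _ r≤N rewrite val-basement F r | T⇒true (NP.≤⇒≤ᵇ r≤N) = refl

-- σ t F exchanges rows l = t+1 and l+1 of F and the entries l and l+1.
σ : ℕ → Filling → Filling
σ t F = map (map (transp (suc t))) (swapAdjacent t F)

transpRow : ℕ → Cell → Cell
transpRow l (i , j) = (transp l i , j)

length-σ : ∀ t F → length (σ t F) ≡ length F
length-σ t F = trans (LP.length-map _ (swapAdjacent t F)) (length-swapAdjacent t F)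

rowLen-σ : ∀ t F → suc t < length F → ∀ i → rowLen (σ t F) i ≡ rowLen F (transp (suc t) i)
rowLen-σ t F bound zero = refl
rowLen-σ t F bound (suc i)
  rewrite transp-suc t i | nth-map (map (transp (suc t))) (swapAdjacent t F) i | nth-swapAdjacent t F bound i
  with nth F (transp t i)
... | nothing = refl
... | just r = cong (λ k → fromMaybe 0 (just k)) (LP.length-map _ r)

inside-transp : ∀ t N i → suc t < N → (suc i ≤ᵇ N) ≡ (suc (transp t i) ≤ᵇ N)
inside-transp t N i bound = T-ext (λ h → NP.≤⇒≤ᵇ (to (NP.≤ᵇ⇒≤ _ _ h))) (λ h → NP.≤⇒≤ᵇ (from (NP.≤ᵇ⇒≤ _ _ h)))
  where
  to : suc i ≤ N → suc (transp t i) ≤ N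
  to i<N with position t i
  ... | at-p refl rewrite transp-p t = bound
  ... | at-1+p refl rewrite transp-1+p t = NP.<-trans (NP.n<1+n _) bound
  ... | elsewhere e₁ e₂ rewrite transp-elsewhere e₁ e₂ = i<N
  from : suc (transp t i) ≤ N → suc i ≤ N
  from si<N with position t i
  ... | at-p refl = NP.<-trans (NP.n<1+n _) bound
  ... | at-1+p refl = bound
  ... | elsewhere e₁ e₂ rewrite transp-elsewhere e₁ e₂ = si<N

-- The basement is fixed by σ: moving row i to row sₗ i and relabelling by sₗ
-- restores the label i.
val-σ-basement : ∀ t F → suc t < length F → ∀ i →
  val (σ t F) (suc i , 0) ≡ transp (suc t) (val F (transp (suc t) (suc i) , 0))
val-σ-basement t F bound i
  rewrite val-basement (σ t F) i | length-σ t F | transp-suc t i | val-basement F (transp t i)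
  | inside-transp t (length F) i bound with suc (transp t i) ≤ᵇ length F
... | true = trans (sym (cong suc (transp-involutive t i))) (sym (transp-suc t (transp t i)))
... | false = refl

val-σ : ∀ t F → suc t < length F → ∀ i j → val (σ t F) (i , j) ≡ transp (suc t) (val F (transpRow (suc t) (i , j)))
val-σ t F bound zero j = refl
val-σ t F bound (suc i) zero = val-σ-basement t F bound i
val-σ t F bound (suc i) (suc j)
  rewrite transp-suc t i | nth-map (map (transp (suc t))) (swapAdjacent t F) i | nth-swapAdjacent t F bound i
  with nth F (transp t i)
... | nothing = refl
... | just r rewrite nth-map (transp (suc t)) r j with nth r j
...   | nothing = refl
...   | just x = refl

-- Sums over the cells of a diagram.  diagSum c g L N sums g over the cells
-- (i , c + y) with 1 ≤ i ≤ N and y < L i: with c = 1 and L = rowLen F these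
-- are the cells of F, with c = 0 and L i = 1 + rowLen F i the cells of the
-- augmented diagram.  pairSum h N sums h over pairs of rows.
module DiagramSums {A : Set} {_⊙_ : A → A → A} {e : A}
  (M : IsCommutativeMonoid _≡_ _⊙_ e) where

  open BigOp M

  diagSum : ℕ → (Cell → A) → (ℕ → ℕ) → ℕ → A
  diagSum c g L N = ⨁< N (λ x → ⨁< (L (suc x)) (λ y → g (suc x , c + y)))

  ⨁-cells : (g : Cell → A) (F : Filling) → ⨁ g (cells F) ≡ diagSum 1 g (rowLen F) (length F)
  ⨁-cells g F = begin
      ⨁ g (cells F)
    ≡⟨ ⨁-concatMap g _ (rows F) ⟩
      ⨁ (λ i → ⨁ g (map (λ j → (i , j)) (map suc (upTo (rowLen F i))))) (map suc (upTo (length F)))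
    ≡⟨ ⨁-map _ suc (upTo (length F)) ⟩
      ⨁< (length F) (λ x → ⨁ g (map (λ j → (suc x , j)) (map suc (upTo (rowLen F (suc x))))))
    ≡⟨ ⨁-cong (λ x → trans (⨁-map g _ (map suc (upTo (rowLen F (suc x)))))
                           (⨁-map _ suc (upTo (rowLen F (suc x))))) (upTo (length F)) ⟩
      diagSum 1 g (rowLen F) (length F)
    ∎ where open ≡-Reasoning

  ⨁-augCells : (g : Cell → A) (F : Filling) →
    ⨁ g (augCells F) ≡ diagSum 0 g (λ i → suc (rowLen F i)) (length F)
  ⨁-augCells g F = begin
      ⨁ g (augCells F)
    ≡⟨ ⨁-concatMap g _ (rows F) ⟩
      ⨁ (λ i → ⨁ g (map (λ j → (i , j)) (upTo (suc (rowLen F i))))) (map suc (upTo (length F)))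
    ≡⟨ ⨁-map _ suc (upTo (length F)) ⟩
      ⨁< (length F) (λ x → ⨁ g (map (λ j → (suc x , j)) (upTo (suc (rowLen F (suc x))))))
    ≡⟨ ⨁-cong (λ x → ⨁-map g _ (upTo (suc (rowLen F (suc x))))) (upTo (length F)) ⟩
      diagSum 0 g (λ i → suc (rowLen F i)) (length F)
    ∎ where open ≡-Reasoning

  diagSum-transp : (c : ℕ) (g : Cell → A) (L : ℕ → ℕ) (t N : ℕ) → suc t < N →
    diagSum c (λ q → g (transpRow (suc t) q)) (λ i → L (transp (suc t) i)) N ≡ diagSum c g L N
  diagSum-transp c g L t N bound = trans
    (⨁-cong (λ x → cong₂ (λ i k → ⨁< k (λ y → g (i , c + y))) (transp-suc t x) (cong L (transp-suc t x)))
            (upTo N))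
    (⨁<-transp N t (λ x → ⨁< (L (suc x)) (λ y → g (suc x , c + y))) bound)

  diagSum-σ : (c : ℕ) (k : ℕ → ℕ) (t : ℕ) (F : Filling) → suc t < length F → (g h : Cell → A) →
    (∀ i y → 1 ≤ i → i ≤ length F → y < k (rowLen F (transp (suc t) i)) →
      g (i , c + y) ≡ h (transpRow (suc t) (i , c + y))) →
    diagSum c g (λ i → k (rowLen (σ t F) i)) (length (σ t F)) ≡ diagSum c h (λ i → k (rowLen F i)) (length F)
  diagSum-σ c k t F bound g h eq = begin
      diagSum c g (λ i → k (rowLen (σ t F) i)) (length (σ t F))
    ≡⟨ cong (diagSum c g (λ i → k (rowLen (σ t F) i))) (length-σ t F) ⟩
      diagSum c g (λ i → k (rowLen (σ t F) i)) (length F)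
    ≡⟨ ⨁<-cong (length F) (λ x x<N →
         trans (cong (λ m → ⨁< m (λ y → g (suc x , c + y))) (cong k (rowLen-σ t F bound (suc x))))
               (⨁<-cong _ (λ y y<L → eq (suc x) y (s≤s z≤n) x<N y<L))) ⟩
      diagSum c (λ q → h (transpRow (suc t) q)) (λ i → k (rowLen F (transp (suc t) i))) (length F)
    ≡⟨ diagSum-transp c h (λ i → k (rowLen F i)) t (length F) bound ⟩
      diagSum c h (λ i → k (rowLen F i)) (length F)
    ∎ where open ≡-Reasoning

  pairSum : (ℕ → ℕ → A) → ℕ → A
  pairSum h N = ⨁< N (λ x → ⨁< N (λ y → h (suc x) (suc y)))

  pairSum-cong : {h k : ℕ → ℕ → A} (N : ℕ) →
    (∀ i j → 1 ≤ i → i ≤ N → 1 ≤ j → j ≤ N → h i j ≡ k i j) → pairSum h N ≡ pairSum k N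
  pairSum-cong N eq = ⨁<-cong N (λ x x<N → ⨁<-cong N (λ y y<N → eq (suc x) (suc y) (s≤s z≤n) x<N (s≤s z≤n) y<N))

  pairSum-distrib : (h k : ℕ → ℕ → A) (N : ℕ) →
    pairSum (λ i j → h i j ⊙ k i j) N ≡ pairSum h N ⊙ pairSum k N
  pairSum-distrib h k N = trans (⨁-cong (λ x → ⨁-distrib _ _ (upTo N)) (upTo N)) (⨁-distrib _ _ (upTo N))

  pairSum-transp : (h : ℕ → ℕ → A) (t N : ℕ) → suc t < N →
    pairSum (λ i j → h (transp (suc t) i) (transp (suc t) j)) N ≡ pairSum h N
  pairSum-transp h t N bound = begin
      ⨁< N (λ x → ⨁< N (λ y → h (transp (suc t) (suc x)) (transp (suc t) (suc y))))
    ≡⟨ ⨁-cong (λ x → ⨁-cong (λ y → cong₂ h (transp-suc t x) (transp-suc t y)) (upTo N)) (upTo N) ⟩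
      ⨁< N (λ x → ⨁< N (λ y → h (suc (transp t x)) (suc (transp t y))))
    ≡⟨ ⨁-cong (λ x → ⨁<-transp N t (λ y → h (suc (transp t x)) (suc y)) bound) (upTo N) ⟩
      ⨁< N (λ x → ⨁< N (λ y → h (suc (transp t x)) (suc y)))
    ≡⟨ ⨁<-transp N t (λ x → ⨁< N (λ y → h (suc x) (suc y))) bound ⟩
      pairSum h N
    ∎ where open ≡-Reasoning

  module ConicalDiagram (conical : ∀ x y → x ⊙ y ≡ e → x ≡ e × y ≡ e) where
    open Conical conical

    diagSum-vanishing : (c : ℕ) (g : Cell → A) (L : ℕ → ℕ) (N : ℕ) → diagSum c g L N ≡ e →
      ∀ x y → x < N → y < L (suc x) → g (suc x , c + y) ≡ e
    diagSum-vanishing c g L N sum≡e x y x<N y<L =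
      ⨁<-vanishing (L (suc x)) _ (⨁<-vanishing N _ sum≡e x x<N) y y<L

module DN = DiagramSums NP.+-0-isCommutativeMonoid
module DB = DiagramSums BP.∧-isCommutativeMonoid

-- The statistics of a filling as diagram sums of local terms, each term a
-- function of the row lengths R and the entries v only.  This is what lets
-- the σ-invariance be checked cell by cell.

open DN using (diagSum; pairSum)

indicator : Bool → ℕ
indicator b = if b then 1 else 0

sum-⨁ : {B : Set} (g : B → ℕ) (xs : List B) → sum (map g xs) ≡ ΣN.⨁ g xs
sum-⨁ g [] = refl
sum-⨁ g (x ∷ xs) = cong (g x +_) (sum-⨁ g xs)

and-⨁ : {B : Set} (g : B → Bool) (xs : List B) → and (map g xs) ≡ ΣB.⨁ g xs
and-⨁ g [] = refl
and-⨁ g (x ∷ xs) = cong (g x ∧_) (and-⨁ g xs)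

count-⨁ : {B : Set} (p : B → Bool) (xs : List B) → count p xs ≡ ΣN.⨁ (λ x → indicator (p x)) xs
count-⨁ p [] = refl
count-⨁ p (x ∷ xs) with p x
... | true = cong suc (count-⨁ p xs)
... | false = count-⨁ p xs

majTerm : (ℕ → ℕ) → (Cell → ℕ) → Cell → ℕ
majTerm R v (i , j) = if v (i , j ∸ 1) <ᵇ v (i , j) then (R i ∸ j) + 1 else 0

maj-diagSum : ∀ F → maj F ≡ diagSum 1 (majTerm (rowLen F) (val F)) (rowLen F) (length F)
maj-diagSum F = trans (sum-⨁ _ (cells F)) (DN.⨁-cells _ F)

diffTerm : (Cell → ℕ) → Cell → ℕ
diffTerm v (i , j) = indicator (not (v (i , j) ≡ᵇ v (i , j ∸ 1)))

nDiff-diagSum : ∀ F → nDiff F ≡ diagSum 1 (diffTerm (val F)) (rowLen F) (length F)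
nDiff-diagSum F = trans (count-⨁ _ (cells F)) (DN.⨁-cells _ F)

weightTerm : (Cell → ℕ) → ℕ → Cell → ℕ
weightTerm v l q = indicator (v q ≡ᵇ l)

weight-diagSum : ∀ F l → weight F l ≡ diagSum 1 (weightTerm (val F) l) (rowLen F) (length F)
weight-diagSum F l = trans (count-⨁ _ (cells F)) (DN.⨁-cells _ F)

compatible : (Cell → ℕ) → Cell → Cell → Bool
compatible v c d = not (not (sameCell c d) ∧ attacks c d) ∨ not (v c ≡ᵇ v d)

augDoubleSum : (Cell → Cell → Bool) → (ℕ → ℕ) → ℕ → Bool
augDoubleSum g R N = DB.diagSum 0 (λ c → DB.diagSum 0 (g c) (λ i → suc (R i)) N) (λ i → suc (R i)) N

nonAttacking-augSum : ∀ F → nonAttacking F ≡ augDoubleSum (compatible (val F)) (rowLen F) (length F)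
nonAttacking-augSum F = trans (and-⨁ _ (augCells F))
  (trans (ΣB.⨁-cong (λ c → trans (and-⨁ _ (augCells F)) (DB.⨁-augCells _ F)) (augCells F)) (DB.⨁-augCells _ F))

before : (Cell → ℕ) → Cell → Cell → Bool
before v c d = (v c <ᵇ v d) ∨ ((v c ≡ᵇ v d) ∧ precedes c d)

inversion : (Cell → ℕ) → Cell × Cell × Cell → Bool
inversion v (a , b , c) = (before v a c ∧ before v c b) ∨ (before v c b ∧ before v b a) ∨ (before v b a ∧ before v a c)

tripleA : ℕ → ℕ → ℕ → Cell × Cell × Cell
tripleA i j k = ((i , k) , (j , k) , (i , k ∸ 1))

tripleB : ℕ → ℕ → ℕ → Cell × Cell × Cell
tripleB i j k = ((i , k) , (j , k) , (j , suc k))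

coinvTerm : (Cell → ℕ) → Cell × Cell × Cell → ℕ
coinvTerm v tr = indicator (not (inversion v tr))

coinvA : (ℕ → ℕ) → (Cell → ℕ) → ℕ → ℕ → ℕ
coinvA R v i j = if R j ≤ᵇ R i then ΣN.⨁< (R j) (λ y → coinvTerm v (tripleA i j (suc y))) else 0

coinvB : (ℕ → ℕ) → (Cell → ℕ) → ℕ → ℕ → ℕ
coinvB R v i j = if R i <ᵇ R j then ΣN.⨁< (suc (R i)) (λ k → coinvTerm v (tripleB i j k)) else 0

coinvRows : (ℕ → ℕ) → (Cell → ℕ) → ℕ → ℕ → ℕ
coinvRows R v i j = if i <ᵇ j then coinvA R v i j + coinvB R v i j else 0

⨁-pairsLt : (F : Filling) (h : ℕ × ℕ → ℕ) →
  ΣN.⨁ h (pairsLt F) ≡ pairSum (λ i j → if i <ᵇ j then h (i , j) else 0) (length F)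
⨁-pairsLt F h = begin
    ⨁ h (pairsLt F)
  ≡⟨ ⨁-concatMap h (λ i → map (λ j → (i , j)) (filterᵇ (i <ᵇ_) (rows F))) (rows F) ⟩
    ⨁ (λ i → ⨁ h (map (λ j → (i , j)) (filterᵇ (i <ᵇ_) (rows F)))) (rows F)
  ≡⟨ ⨁-cong (λ i → trans (⨁-map h (λ j → (i , j)) (filterᵇ (i <ᵇ_) (rows F)))
                         (⨁-filter (λ j → h (i , j)) (i <ᵇ_) (rows F))) (rows F) ⟩
    ⨁ (λ i → ⨁ (λ j → if i <ᵇ j then h (i , j) else 0) (rows F)) (rows F)
  ≡⟨ ⨁-map _ suc (upTo (length F)) ⟩
    ⨁< (length F) (λ x → ⨁ (λ j → if suc x <ᵇ j then h (suc x , j) else 0) (rows F))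
  ≡⟨ ⨁-cong (λ x → ⨁-map _ suc (upTo (length F))) (upTo (length F)) ⟩
    pairSum (λ i j → if i <ᵇ j then h (i , j) else 0) (length F)
  ∎ where
  open ≡-Reasoning
  open ΣN

if-+ : ∀ b x y → (if b then x else 0) + (if b then y else 0) ≡ (if b then x + y else 0)
if-+ true x y = refl
if-+ false x y = refl

coinv-pairSum : ∀ F → coinv F ≡ pairSum (coinvRows (rowLen F) (val F)) (length F)
coinv-pairSum F = begin
    coinv F
  ≡⟨ cong₂ _+_ (trans (count-⨁ _ (typeA F)) (⨁-concatMap _ _ (pairsLt F)))
               (trans (count-⨁ _ (typeB F)) (⨁-concatMap _ _ (pairsLt F))) ⟩
    ⨁ (λ { (i , j) → ⨁ (coinvTerm v) (typeAat i j) }) (pairsLt F)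
      + ⨁ (λ { (i , j) → ⨁ (coinvTerm v) (typeBat i j) }) (pairsLt F)
  ≡⟨ cong₂ _+_ (⨁-pairsLt F _) (⨁-pairsLt F _) ⟩
    pairSum (λ i j → if i <ᵇ j then ⨁ (coinvTerm v) (typeAat i j) else 0) N
      + pairSum (λ i j → if i <ᵇ j then ⨁ (coinvTerm v) (typeBat i j) else 0) N
  ≡⟨ sym (DN.pairSum-distrib (λ i j → if i <ᵇ j then ⨁ (coinvTerm v) (typeAat i j) else 0)
                              (λ i j → if i <ᵇ j then ⨁ (coinvTerm v) (typeBat i j) else 0) N) ⟩
    pairSum (λ i j → (if i <ᵇ j then ⨁ (coinvTerm v) (typeAat i j) else 0)
                      + (if i <ᵇ j then ⨁ (coinvTerm v) (typeBat i j) else 0)) N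
  ≡⟨ DN.pairSum-cong N (λ i j _ _ _ _ → trans (if-+ (i <ᵇ j) (⨁ (coinvTerm v) (typeAat i j)) (⨁ (coinvTerm v) (typeBat i j)))
                                               (cong (λ z → if i <ᵇ j then z else 0) (cong₂ _+_ (typeA-sum i j) (typeB-sum i j)))) ⟩
    pairSum (coinvRows R v) N
  ∎ where
  open ≡-Reasoning
  open ΣN
  R = rowLen F
  v = val F
  N = length F
  typeAat : ℕ → ℕ → List (Cell × Cell × Cell)
  typeAat i j = if R j ≤ᵇ R i then map (λ k → ((i , k) , (j , k) , (i , k ∸ 1))) (map suc (upTo (R j))) else []
  typeBat : ℕ → ℕ → List (Cell × Cell × Cell)
  typeBat i j = if R i <ᵇ R j then map (λ k → ((i , k) , (j , k) , (j , suc k))) (upTo (suc (R i))) else []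
  typeA-sum : ∀ i j → ⨁ (coinvTerm v) (typeAat i j) ≡ coinvA R v i j
  typeA-sum i j with R j ≤ᵇ R i
  ... | false = refl
  ... | true = trans (⨁-map _ _ (map suc (upTo (R j)))) (⨁-map _ suc (upTo (R j)))
  typeB-sum : ∀ i j → ⨁ (coinvTerm v) (typeBat i j) ≡ coinvB R v i j
  typeB-sum i j with R i <ᵇ R j
  ... | false = refl
  ... | true = ⨁-map _ _ (upTo (suc (R i)))

weight-σ : ∀ t F → suc t < length F → ∀ j → weight (σ t F) j ≡ weight F (transp (suc t) j)
weight-σ t F bound j = begin
    weight (σ t F) j
  ≡⟨ weight-diagSum (σ t F) j ⟩
    diagSum 1 (weightTerm (val (σ t F)) j) (rowLen (σ t F)) (length (σ t F))
  ≡⟨ DN.diagSum-σ 1 (λ k → k) t F bound (weightTerm (val (σ t F)) j) (weightTerm (val F) (transp l j))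
         (λ i y _ _ _ → term i (suc y)) ⟩
    diagSum 1 (weightTerm (val F) (transp l j)) (rowLen F) (length F)
  ≡⟨ sym (weight-diagSum F (transp l j)) ⟩
    weight F (transp l j)
  ∎ where
  open ≡-Reasoning
  l = suc t
  term : ∀ i k → weightTerm (val (σ t F)) j (i , k) ≡ weightTerm (val F) (transp l j) (transp l i , k)
  term i k rewrite val-σ t F bound i k =
    cong indicator (trans (cong (transp l (val F (transp l i , k)) ≡ᵇ_) (sym (transp-involutive l j)))
                          (transp-≡ᵇ l (val F (transp l i , k)) (transp l j)))

record Vacant (t : ℕ) (F : Filling) : Set where
  field
    bound : suc t < length F
    row-empty : rowLen F (suc (suc t)) ≡ 0
    value-absent : weight F (suc (suc t)) ≡ 0

transp-inside : ∀ t N i → suc t < N → 1 ≤ i → i ≤ N → 1 ≤ transp (suc t) i × transp (suc t) i ≤ N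
transp-inside t N i l<N 1≤i i≤N with position (suc t) i
... | at-p refl rewrite transp-p (suc t) = s≤s z≤n , l<N
... | at-1+p refl rewrite transp-1+p (suc t) = s≤s z≤n , NP.<⇒≤ l<N
... | elsewhere e₁ e₂ rewrite transp-elsewhere e₁ e₂ = 1≤i , i≤N

module VacantFilling (t : ℕ) (F : Filling) (H : Vacant t F) where
  open Vacant H public
  l = suc t
  N = length F
  R = rowLen F
  v = val F

  entry≢l+1 : ∀ r k → 1 ≤ r → r ≤ N → r ≢ suc l → k ≤ R r → v (r , k) ≢ suc l
  entry≢l+1 r zero 1≤r r≤N r≢l+1 _ rewrite val-basement-inside F r 1≤r r≤N = r≢l+1
  entry≢l+1 (suc r) (suc k) _ r<N _ k<R v≡l+1 with
    DN.ConicalDiagram.diagSum-vanishing +-conical 1 (weightTerm v (suc l)) R N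
      (trans (sym (weight-diagSum F (suc l))) value-absent) r k r<N k<R
  ... | term≡0 rewrite v≡l+1 | ≡ᵇ-refl (suc l) with term≡0
  ...   | ()

  nonempty≢l+1 : ∀ r → 0 < R r → r ≢ suc l
  nonempty≢l+1 r 0<R refl rewrite row-empty = NP.<-irrefl refl 0<R

  entry-avoids : ∀ r k → 1 ≤ r → r ≤ N → 0 < R r → k ≤ R r → v (r , k) ≢ suc l
  entry-avoids r k 1≤r r≤N 0<R = entry≢l+1 r k 1≤r r≤N (nonempty≢l+1 r 0<R)

  transp-inside-rows : ∀ i → 1 ≤ i → i ≤ N → 1 ≤ transp l i × transp l i ≤ N
  transp-inside-rows i = transp-inside t N i bound

  transp-<ᵇ-row : ∀ r k k' → 1 ≤ r × r ≤ N → 0 < R r → k ≤ R r → k' ≤ R r →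
    (transp l (v (r , k)) <ᵇ transp l (v (r , k'))) ≡ (v (r , k) <ᵇ v (r , k'))
  transp-<ᵇ-row r k k' (1≤r , r≤N) 0<R k≤R k'≤R = transp-<ᵇ l (v (r , k)) (v (r , k'))
    ((λ p → entry-avoids r k' 1≤r r≤N 0<R k'≤R (proj₂ p)) , (λ p → entry-avoids r k 1≤r r≤N 0<R k≤R (proj₁ p)))

  vσ : Cell → ℕ
  vσ q = transp l (v (transpRow l q))

  maj-σ : maj (σ t F) ≡ maj F
  maj-σ = begin
      maj (σ t F)
    ≡⟨ maj-diagSum (σ t F) ⟩
      diagSum 1 (majTerm (rowLen (σ t F)) (val (σ t F))) (rowLen (σ t F)) (length (σ t F))
    ≡⟨ DN.diagSum-σ 1 (λ k → k) t F bound (majTerm (rowLen (σ t F)) (val (σ t F))) (majTerm R v) term ⟩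
      diagSum 1 (majTerm R v) R N
    ≡⟨ sym (maj-diagSum F) ⟩
      maj F
    ∎ where
    open ≡-Reasoning
    -- a descent stays a descent, as sₗ preserves the order of entries ≠ l+1
    term : ∀ i y → 1 ≤ i → i ≤ N → y < R (transp l i) →
      majTerm (rowLen (σ t F)) (val (σ t F)) (i , suc y) ≡ majTerm R v (transpRow l (i , suc y))
    term i y 1≤i i≤N y<R
      rewrite val-σ t F bound i (suc y) | val-σ t F bound i y | rowLen-σ t F bound i
      | transp-<ᵇ-row (transp l i) y (suc y) (transp-inside-rows i 1≤i i≤N) (NP.≤-trans (s≤s z≤n) y<R)
          (NP.<⇒≤ y<R) y<R = refl

  nDiff-σ : nDiff (σ t F) ≡ nDiff F
  nDiff-σ = begin
      nDiff (σ t F)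
    ≡⟨ nDiff-diagSum (σ t F) ⟩
      diagSum 1 (diffTerm (val (σ t F))) (rowLen (σ t F)) (length (σ t F))
    ≡⟨ DN.diagSum-σ 1 (λ k → k) t F bound (diffTerm (val (σ t F))) (diffTerm v) (λ i y _ _ _ → term i (suc y)) ⟩
      diagSum 1 (diffTerm v) R N
    ≡⟨ sym (nDiff-diagSum F) ⟩
      nDiff F
    ∎ where
    open ≡-Reasoning
    term : ∀ i k → diffTerm (val (σ t F)) (i , k) ≡ diffTerm v (transpRow l (i , k))
    term i k rewrite val-σ t F bound i k | val-σ t F bound i (k ∸ 1) =
      cong (λ b → indicator (not b)) (transp-≡ᵇ l (v (transp l i , k)) (v (transp l i , k ∸ 1)))

  data RowPair (i i' : ℕ) : Set where
    lower-upper : i' ≡ l → i ≡ suc l → RowPair i i'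
    upper-lower : i' ≡ suc l → i ≡ l → RowPair i i'
    other : NotAdjacentPair l i' i → RowPair i i'

  rowPair : ∀ i i' → RowPair i i'
  rowPair i i' with i' NP.≟ l | i NP.≟ suc l | i' NP.≟ suc l | i NP.≟ l
  ... | yes a | yes b | _ | _ = lower-upper a b
  ... | _ | _ | yes c | yes d = upper-lower c d
  ... | no a | _ | no c | _ = other ((λ p → a (proj₁ p)) , (λ p → c (proj₁ p)))
  ... | no a | _ | yes c | no d = other ((λ p → a (proj₁ p)) , (λ p → d (proj₂ p)))
  ... | yes a | no b | no c | _ = other ((λ p → b (proj₂ p)) , (λ p → c (proj₁ p)))
  ... | yes a | no b | yes c | _ = ⊥-elim (NP.1+n≢n {l} (trans (sym c) a))

  -- Attacks between rows l and l+1 change direction, but row l+1 of F is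
  -- empty, and the only new attacking pair (l+1,1),(l,0) of σ t F carries the
  -- entries of (l,1) and (l+1,0) in F, which differ.
  compatible-σ : ∀ i k i' k' → 1 ≤ i → i ≤ N → k ≤ R (transp l i) → k' ≤ R (transp l i') →
    compatible vσ (i , k) (i' , k') ≡ compatible v (transpRow l (i , k)) (transpRow l (i' , k'))
  compatible-σ i k i' k' 1≤i i≤N k≤R k'≤R
    rewrite transp-≡ᵇ l (v (transp l i , k)) (v (transp l i' , k')) | transp-≡ᵇ l i i' with rowPair i i'
  ... | other apart rewrite transp-<ᵇ l i' i apart = refl
  ... | upper-lower refl refl rewrite transp-p l | row-empty | NP.n≤0⇒n≡0 k≤R = refl
  ... | lower-upper refl refl rewrite transp-p l | transp-1+p l | row-empty | NP.n≤0⇒n≡0 k'≤R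
        | n<ᵇ1+n l | 1+n<ᵇn l | ≢⇒≡ᵇ-false (NP.1+n≢n {l}) with k
  ...   | zero = refl
  ...   | suc (suc k₂) = refl
  ...   | suc zero rewrite val-basement-inside F (suc l) (s≤s z≤n) bound
          | ≢⇒≡ᵇ-false (entry≢l+1 l 1 (s≤s z≤n) (NP.<⇒≤ bound) (λ e → NP.1+n≢n {l} (sym e)) k≤R) = refl

  nonAttacking-σ : nonAttacking (σ t F) ≡ nonAttacking F
  nonAttacking-σ = begin
      nonAttacking (σ t F)
    ≡⟨ nonAttacking-augSum (σ t F) ⟩
      augDoubleSum (compatible (val (σ t F))) (rowLen (σ t F)) (length (σ t F))
    ≡⟨ DB.diagSum-σ 0 suc t F bound (λ c → DB.diagSum 0 (compatible (val (σ t F)) c) R'σ (length (σ t F)))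
         (λ c → DB.diagSum 0 (compatible v c) R' N)
         (λ i y 1≤i i≤N y≤R → DB.diagSum-σ 0 suc t F bound (compatible (val (σ t F)) (i , y)) (compatible v (transpRow l (i , y)))
           (λ i' y' _ _ y'≤R → trans (compatible-val i y i' y')
                                     (compatible-σ i y i' y' 1≤i i≤N (NP.≤-pred y≤R) (NP.≤-pred y'≤R)))) ⟩
      augDoubleSum (compatible v) R N
    ≡⟨ sym (nonAttacking-augSum F) ⟩
      nonAttacking F
    ∎ where
    open ≡-Reasoning
    R'σ R' : ℕ → ℕ
    R'σ i = suc (rowLen (σ t F) i)
    R' i = suc (R i)
    compatible-val : ∀ i k i' k' → compatible (val (σ t F)) (i , k) (i' , k') ≡ compatible vσ (i , k) (i' , k')
    compatible-val i k i' k' rewrite val-σ t F bound i k | val-σ t F bound i' k' = refl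

-- Every triple of σ t F is the σ-image of a triple of F with the same
-- inversion status, except the type B triple (l,0),(l+1,0),(l+1,1), which
-- comes from the empty row l+1 of F and is an inversion.
module CoinvInvariance (t : ℕ) (F : Filling) (H : Vacant t F)
  (first-column : ∀ r → 1 ≤ r → r ≤ length F → 0 < rowLen F r → val F (r , 1) ≡ r) where
  open VacantFilling t F H

  Rσ : ℕ → ℕ
  Rσ i = R (transp l i)

  NotAdjacentPair-sym : ∀ {x y} → NotAdjacentPair l x y → NotAdjacentPair l y x
  NotAdjacentPair-sym (n₁ , n₂) = (λ p → n₂ (proj₂ p , proj₁ p)) , (λ p → n₁ (proj₂ p , proj₁ p))

  NotAdjacentPair-refl : ∀ x → NotAdjacentPair l x x
  NotAdjacentPair-refl x = (λ p → NP.1+n≢n {l} (trans (sym (proj₂ p)) (proj₁ p)))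
                         , (λ p → NP.1+n≢n {l} (trans (sym (proj₁ p)) (proj₂ p)))

  avoiding-l+1 : ∀ {x y} → x ≢ suc l → y ≢ suc l → NotAdjacentPair l x y
  avoiding-l+1 x≢ y≢ = (λ p → y≢ (proj₂ p)) , (λ p → x≢ (proj₁ p))

  avoiding-l : ∀ {x y} → x ≢ l → y ≢ l → NotAdjacentPair l x y
  avoiding-l x≢ y≢ = (λ p → x≢ (proj₁ p)) , (λ p → y≢ (proj₂ p))

  precedes-σ : ∀ i k i' k' → NotAdjacentPair l i i' →
    precedes (i , k) (i' , k') ≡ precedes (transpRow l (i , k)) (transpRow l (i' , k'))
  precedes-σ i k i' k' apart rewrite transp-<ᵇ l i i' apart | transp-≡ᵇ l i i' = refl

  before-σ : ∀ p q → NotAdjacentPair l (v (transpRow l p)) (v (transpRow l q)) →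
    precedes p q ≡ precedes (transpRow l p) (transpRow l q) →
    before vσ p q ≡ before v (transpRow l p) (transpRow l q)
  before-σ p q apart same-order rewrite transp-<ᵇ l (v (transpRow l p)) (v (transpRow l q)) apart
    | transp-≡ᵇ l (v (transpRow l p)) (v (transpRow l q)) | same-order = refl

  inversion-σ : ∀ a b c →
    NotAdjacentPair l (v (transpRow l a)) (v (transpRow l c)) →
    NotAdjacentPair l (v (transpRow l c)) (v (transpRow l b)) →
    NotAdjacentPair l (v (transpRow l b)) (v (transpRow l a)) →
    precedes a c ≡ precedes (transpRow l a) (transpRow l c) →
    precedes c b ≡ precedes (transpRow l c) (transpRow l b) →
    precedes b a ≡ precedes (transpRow l b) (transpRow l a) →
    inversion vσ (a , b , c) ≡ inversion v (transpRow l a , transpRow l b , transpRow l c)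
  inversion-σ a b c ac cb ba pac pcb pba
    rewrite before-σ a c ac pac | before-σ c b cb pcb | before-σ b a ba pba = refl

  if-cong : ∀ (b : Bool) {x y : ℕ} → (T b → x ≡ y) → (if b then x else 0) ≡ (if b then y else 0)
  if-cong true f = f _
  if-cong false f = refl

  coinvA-σ : ∀ i j → 1 ≤ i × i ≤ N → 1 ≤ j × j ≤ N → NotAdjacentPair l i j →
    coinvA Rσ vσ i j ≡ coinvA R v (transp l i) (transp l j)
  coinvA-σ i j i-row j-row apart = if-cong (R j' ≤ᵇ R i')
    (λ le → ΣN.⨁<-cong (R j') (λ y y<R → cong (λ b → indicator (not b)) (triple y (NP.≤ᵇ⇒≤ _ _ le) y<R)))
    where
    i' = transp l i
    j' = transp l j
    i'-row = transp-inside-rows i (proj₁ i-row) (proj₂ i-row)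
    j'-row = transp-inside-rows j (proj₁ j-row) (proj₂ j-row)
    triple : ∀ y → R j' ≤ R i' → y < R j' → inversion vσ (tripleA i j (suc y)) ≡ inversion v (tripleA i' j' (suc y))
    triple y le y<R = inversion-σ (i , suc y) (j , suc y) (i , y)
        (avoiding-l+1 a c) (avoiding-l+1 c b) (avoiding-l+1 b a)
        (precedes-σ i (suc y) i y (NotAdjacentPair-refl i)) (precedes-σ i y j (suc y) apart)
        (precedes-σ j (suc y) i (suc y) (NotAdjacentPair-sym apart))
      where
      0<Rj' = NP.≤-trans (s≤s z≤n) y<R
      0<Ri' = NP.≤-trans 0<Rj' le
      a = entry-avoids i' (suc y) (proj₁ i'-row) (proj₂ i'-row) 0<Ri' (NP.≤-trans y<R le)
      b = entry-avoids j' (suc y) (proj₁ j'-row) (proj₂ j'-row) 0<Rj' y<R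
      c = entry-avoids i' y (proj₁ i'-row) (proj₂ i'-row) 0<Ri' (NP.≤-trans (NP.<⇒≤ y<R) le)

  -- A type B triple (i',k),(j',k),(j',k+1) of F with i' ≠ l+1 (i' = sₗ i,
  -- j' = sₗ j) has no entry l+1, so it keeps its inversion status.
  tripleB-generic : ∀ i j k → 1 ≤ i × i ≤ N → 1 ≤ j × j ≤ N → NotAdjacentPair l i j →
    R (transp l i) < R (transp l j) → k ≤ R (transp l i) → transp l i ≢ suc l →
    inversion vσ (tripleB i j k) ≡ inversion v (tripleB (transp l i) (transp l j) k)
  tripleB-generic i j k i-row j-row apart lt k≤R i'≢l+1 = inversion-σ (i , k) (j , k) (j , suc k)
      (avoiding-l+1 a c) (avoiding-l+1 c b) (avoiding-l+1 b a)
      (precedes-σ i k j (suc k) apart) (precedes-σ j (suc k) j k (NotAdjacentPair-refl j))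
      (precedes-σ j k i k (NotAdjacentPair-sym apart))
    where
    i' = transp l i
    j' = transp l j
    i'-row = transp-inside-rows i (proj₁ i-row) (proj₂ i-row)
    j'-row = transp-inside-rows j (proj₁ j-row) (proj₂ j-row)
    j'≢l+1 = nonempty≢l+1 j' (NP.≤-trans (s≤s z≤n) lt)
    a = entry≢l+1 i' k (proj₁ i'-row) (proj₂ i'-row) i'≢l+1 k≤R
    b = entry≢l+1 j' k (proj₁ j'-row) (proj₂ j'-row) j'≢l+1 (NP.≤-trans k≤R (NP.<⇒≤ lt))
    c = entry≢l+1 j' (suc k) (proj₁ j'-row) (proj₂ j'-row) j'≢l+1 (NP.≤-trans (s≤s k≤R) lt)

  -- A type B triple (l+1,0),(j',0),(j',1) of F with l+1 < j': its entries
  -- l+1, j', j' (basement and first column) form no adjacent pair.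
  tripleB-empty-row : ∀ i j → 1 ≤ j × j ≤ N → NotAdjacentPair l i j → transp l i < transp l j →
    0 < R (transp l j) → transp l i ≡ suc l →
    inversion vσ (tripleB i j 0) ≡ inversion v (tripleB (transp l i) (transp l j) 0)
  tripleB-empty-row i j j-row apart i'<j' 0<R i'≡l+1 = inversion-σ (i , 0) (j , 0) (j , 1)
      (avoid-ac , (λ p → c≢l (proj₂ p))) (avoiding-l c≢l b≢l) ((λ p → b≢l (proj₁ p)) , (λ p → b≢l+1 (proj₁ p)))
      (precedes-σ i 0 j 1 apart) (precedes-σ j 1 j 0 (NotAdjacentPair-refl j))
      (precedes-σ j 0 i 0 (NotAdjacentPair-sym apart))
    where
    j' = transp l j
    j'-row = transp-inside-rows j (proj₁ j-row) (proj₂ j-row)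
    j'≢l : j' ≢ l
    j'≢l e = NP.<-asym i'<j' (subst₂ _<_ (sym e) (sym i'≡l+1) (NP.n<1+n l))
    j'≢l+1 : j' ≢ suc l
    j'≢l+1 e = NP.<-irrefl (trans i'≡l+1 (sym e)) i'<j'
    b≡j' : v (j' , 0) ≡ j'
    b≡j' = val-basement-inside F j' (proj₁ j'-row) (proj₂ j'-row)
    c≡j' : v (j' , 1) ≡ j'
    c≡j' = first-column j' (proj₁ j'-row) (proj₂ j'-row) 0<R
    b≢l : v (j' , 0) ≢ l
    b≢l e = j'≢l (trans (sym b≡j') e)
    b≢l+1 : v (j' , 0) ≢ suc l
    b≢l+1 e = j'≢l+1 (trans (sym b≡j') e)
    c≢l : v (j' , 1) ≢ l
    c≢l e = j'≢l (trans (sym c≡j') e)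
    avoid-ac : ¬ (v (transp l i , 0) ≡ l × v (j' , 1) ≡ suc l)
    avoid-ac p = j'≢l+1 (trans (sym c≡j') (proj₂ p))

  coinvB-σ : ∀ i j → 1 ≤ i × i ≤ N → 1 ≤ j × j ≤ N → NotAdjacentPair l i j → transp l i < transp l j →
    coinvB Rσ vσ i j ≡ coinvB R v (transp l i) (transp l j)
  coinvB-σ i j i-row j-row apart i'<j' = if-cong (R i' <ᵇ R j')
    (λ lt → ΣN.⨁<-cong (suc (R i')) (λ k k<R → cong (λ b → indicator (not b))
      (triple k (NP.<ᵇ⇒< _ _ lt) (NP.≤-pred k<R))))
    where
    i' = transp l i
    j' = transp l j
    triple : ∀ k → R i' < R j' → k ≤ R i' → inversion vσ (tripleB i j k) ≡ inversion v (tripleB i' j' k)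
    triple k lt k≤R with i' NP.≟ suc l
    ... | no i'≢l+1 = tripleB-generic i j k i-row j-row apart lt k≤R i'≢l+1
    ... | yes i'≡l+1 with NP.n≤0⇒n≡0 (subst (k ≤_) (trans (cong R i'≡l+1) row-empty) k≤R)
    ...   | refl = tripleB-empty-row i j j-row apart i'<j' (NP.≤-trans (s≤s z≤n) lt) i'≡l+1

  -- The triple (l,0),(l+1,0),(l+1,1) of σ t F has entries l, l+1, l+1.
  -- (With entries l, l+1, l+1 it is an inversion: a < c < b by reading order.)
  special-triple-inversion : 0 < R l → inversion vσ ((l , 0) , (suc l , 0) , (suc l , 1)) ≡ true
  special-triple-inversion 0<R = entries-l-l+1-l+1 {vσ} a≡l b≡l+1 c≡l+1
    where
    entries-l-l+1-l+1 : ∀ {w : Cell → ℕ} → w (l , 0) ≡ l → w (suc l , 0) ≡ suc l → w (suc l , 1) ≡ suc l →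
      inversion w ((l , 0) , (suc l , 0) , (suc l , 1)) ≡ true
    entries-l-l+1-l+1 a b c rewrite a | b | c | n<ᵇ1+n l | n<ᵇn (suc l) | ≡ᵇ-refl (suc l) = refl
    l≤N = NP.<⇒≤ bound
    a≡l : vσ (l , 0) ≡ l
    a≡l = trans (cong (λ r → transp l (v (r , 0))) (transp-p l))
                (trans (cong (transp l) (val-basement-inside F (suc l) (s≤s z≤n) bound)) (transp-1+p l))
    b≡l+1 : vσ (suc l , 0) ≡ suc l
    b≡l+1 = trans (cong (λ r → transp l (v (r , 0))) (transp-1+p l))
                  (trans (cong (transp l) (val-basement-inside F l (s≤s z≤n) l≤N)) (transp-p l))
    c≡l+1 : vσ (suc l , 1) ≡ suc l
    c≡l+1 = trans (cong (λ r → transp l (v (r , 1))) (transp-1+p l))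
                  (trans (cong (transp l) (first-column l (s≤s z≤n) l≤N 0<R)) (transp-p l))

  Rσ-l : Rσ l ≡ 0
  Rσ-l = trans (cong R (transp-p l)) row-empty

  Rσ-l+1 : Rσ (suc l) ≡ R l
  Rσ-l+1 = cong R (transp-1+p l)

  coinvA-special : coinvA Rσ vσ l (suc l) ≡ 0
  coinvA-special rewrite Rσ-l | Rσ-l+1 with R l
  ... | zero = refl
  ... | suc m = refl

  coinvB-special : coinvB Rσ vσ l (suc l) ≡ 0
  coinvB-special rewrite Rσ-l | Rσ-l+1 with R l in eq
  ... | zero = refl
  ... | suc m = cong (λ b → indicator (not b) + 0) (special-triple-inversion (subst (0 <_) (sym eq) (s≤s z≤n)))

  coinvRows-special : coinvRows Rσ vσ l (suc l) ≡ 0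
  coinvRows-special = trans (cong (λ b → if b then coinvA Rσ vσ l (suc l) + coinvB Rσ vσ l (suc l) else 0) (n<ᵇ1+n l))
                            (cong₂ _+_ coinvA-special coinvB-special)

  coinvRows-σ : ∀ i j → 1 ≤ i → i ≤ N → 1 ≤ j → j ≤ N → coinvRows Rσ vσ i j ≡ coinvRows R v (transp l i) (transp l j)
  coinvRows-σ i j 1≤i i≤N 1≤j j≤N with rowPair j i
  ... | upper-lower refl refl rewrite transp-1+p l | transp-p l | 1+n<ᵇn l | n<ᵇ1+n l | row-empty = refl
  ... | lower-upper refl refl rewrite coinvRows-special | transp-p l | transp-1+p l | 1+n<ᵇn l = refl
  ... | other apart = trans
        (if-cong (i <ᵇ j) (λ i<j → cong₂ _+_ (coinvA-σ i j (1≤i , i≤N) (1≤j , j≤N) apart)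
          (coinvB-σ i j (1≤i , i≤N) (1≤j , j≤N) apart (NP.<ᵇ⇒< _ _ (true⇒T (trans (transp-<ᵇ l i j apart) (T⇒true i<j)))))))
        (cong (λ b → if b then coinvA R v (transp l i) (transp l j) + coinvB R v (transp l i) (transp l j) else 0)
              (sym (transp-<ᵇ l i j apart)))

  inversion-cong : {v₁ v₂ : Cell → ℕ} → (∀ q → v₁ q ≡ v₂ q) → ∀ a b c → inversion v₁ (a , b , c) ≡ inversion v₂ (a , b , c)
  inversion-cong eq a b c rewrite eq a | eq b | eq c = refl

  coinvRows-cong : {R₁ R₂ : ℕ → ℕ} {v₁ v₂ : Cell → ℕ} → (∀ x → R₁ x ≡ R₂ x) → (∀ q → v₁ q ≡ v₂ q) →
    ∀ i j → coinvRows R₁ v₁ i j ≡ coinvRows R₂ v₂ i j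
  coinvRows-cong {R₁} {R₂} eR ev i j rewrite eR i | eR j =
    cong (λ z → if i <ᵇ j then z else 0) (cong₂ _+_
      (cong (λ z → if R₂ j ≤ᵇ R₂ i then z else 0)
            (ΣN.⨁-cong (λ y → cong (λ b → indicator (not b)) (inversion-cong ev _ _ _)) (upTo (R₂ j))))
      (cong (λ z → if R₂ i <ᵇ R₂ j then z else 0)
            (ΣN.⨁-cong (λ k → cong (λ b → indicator (not b)) (inversion-cong ev _ _ _)) (upTo (suc (R₂ i))))))

  coinv-σ : coinv (σ t F) ≡ coinv F
  coinv-σ = begin
      coinv (σ t F)
    ≡⟨ coinv-pairSum (σ t F) ⟩
      pairSum (coinvRows (rowLen (σ t F)) (val (σ t F))) (length (σ t F))
    ≡⟨ cong (pairSum (coinvRows (rowLen (σ t F)) (val (σ t F)))) (length-σ t F) ⟩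
      pairSum (coinvRows (rowLen (σ t F)) (val (σ t F))) N
    ≡⟨ DN.pairSum-cong N (λ i j _ _ _ _ → coinvRows-cong (rowLen-σ t F bound) (λ { (a , b) → val-σ t F bound a b }) i j) ⟩
      pairSum (coinvRows Rσ vσ) N
    ≡⟨ DN.pairSum-cong N coinvRows-σ ⟩
      pairSum (λ i j → coinvRows R v (transp l i) (transp l j)) N
    ≡⟨ DN.pairSum-transp (coinvRows R v) t N bound ⟩
      pairSum (coinvRows R v) N
    ≡⟨ sym (coinv-pairSum F) ⟩
      coinv F
    ∎ where open ≡-Reasoning

-- Admissible fillings (non-attacking, maj = 0) have the identity as first
-- column.  For the fillings enumerated in L_α all entries are ≥ 1; only the
-- first column matters here.
FirstColumnPositive : Filling → Set
FirstColumnPositive F = ∀ r → 1 ≤ r → r ≤ length F → 0 < rowLen F r → 1 ≤ val F (r , 1)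

-- The cell (r,1) holds r: it is at most r, as an ascent from the basement
-- would contribute to maj; it is at least r, as an entry p < r would attack
-- the basement cell (p,0), which holds p.
first-column-identity : (F : Filling) → nonAttacking F ≡ true → maj F ≡ 0 → FirstColumnPositive F →
  ∀ r → 1 ≤ r → r ≤ length F → 0 < rowLen F r → val F (r , 1) ≡ r
first-column-identity F nonAtt maj≡0 positive (suc x) _ r≤N 0<R = NP.≤-antisym at-most at-least
  where
  R = rowLen F
  v = val F
  N = length F
  r = suc x
  no-ascent : (v (r , 0) <ᵇ v (r , 1)) ≡ false
  no-ascent with v (r , 0) <ᵇ v (r , 1)
               | DN.ConicalDiagram.diagSum-vanishing +-conical 1 (majTerm R v) R N
                   (trans (sym (maj-diagSum F)) maj≡0) x 0 r≤N 0<R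
  ... | false | _ = refl
  ... | true | term≡0 with trans (NP.+-comm 1 (R r ∸ 1)) term≡0
  ...   | ()
  at-most : v (r , 1) ≤ r
  at-most = subst (v (r , 1) ≤_) (val-basement-inside F r (s≤s z≤n) r≤N)
                  (NP.≮⇒≥ (λ lt → subst T no-ascent (NP.<⇒<ᵇ lt)))
  compatible-with-basement : ∀ p → 1 ≤ p → p ≤ N → compatible v (r , 1) (p , 0) ≡ true
  compatible-with-basement (suc p) _ p≤N =
    DB.ConicalDiagram.diagSum-vanishing ∧-conical 0 (compatible v (r , 1)) (λ i → suc (R i)) N
      (DB.ConicalDiagram.diagSum-vanishing ∧-conical 0 (λ c → DB.diagSum 0 (compatible v c) (λ i → suc (R i)) N) (λ i → suc (R i)) N
         (trans (sym (nonAttacking-augSum F)) nonAtt) x 1 r≤N (s≤s 0<R))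
      p 0 p≤N (s≤s z≤n)
  at-least : r ≤ v (r , 1)
  at-least = NP.≮⇒≥ attacks-basement
    where
    attacks-basement : v (r , 1) < r → ⊥
    attacks-basement lt with compatible-with-basement (v (r , 1)) (positive r (s≤s z≤n) r≤N 0<R)
                                                       (NP.≤-trans (NP.<⇒≤ lt) r≤N)
    ... | compat rewrite val-basement-inside F (v (r , 1)) (positive r (s≤s z≤n) r≤N 0<R) (NP.≤-trans (NP.<⇒≤ lt) r≤N)
          | BP.∧-zeroʳ (r ≡ᵇ v (r , 1)) | ≡ᵇ-refl (v (r , 1)) | T⇒true (NP.<⇒<ᵇ lt) with compat
    ... | ()

row-empty-if-absent : (F : Filling) → nonAttacking F ≡ true → maj F ≡ 0 → FirstColumnPositive F →
  ∀ j → 1 ≤ j → j ≤ length F → weight F j ≡ 0 → rowLen F j ≡ 0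
row-empty-if-absent F nonAtt maj≡0 positive (suc x) _ j≤N weight≡0 with rowLen F (suc x) in eq
... | zero = refl
... | suc k with DN.ConicalDiagram.diagSum-vanishing +-conical 1 (weightTerm (val F) (suc x)) (rowLen F) (length F)
                   (trans (sym (weight-diagSum F (suc x))) weight≡0) x 0 j≤N (subst (0 <_) (sym eq) (s≤s z≤n))
... | term≡0 rewrite first-column-identity F nonAtt maj≡0 positive (suc x) (s≤s z≤n) j≤N (subst (0 <_) (sym eq) (s≤s z≤n))
      | ≡ᵇ-refl x with term≡0
... | ()

coeffP-⊕ : ∀ p q m → coeffP (p ⊕ q) m ≡ coeffP p m ℤ.+ coeffP q m
coeffP-⊕ [] q m = sym (ZP.+-identityˡ _)
coeffP-⊕ (a ∷ p) [] m = sym (ZP.+-identityʳ _)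
coeffP-⊕ (a ∷ p) (b ∷ q) zero = refl
coeffP-⊕ (a ∷ p) (b ∷ q) (suc m) = coeffP-⊕ p q m

coeffP-sumP : ∀ ps m → coeffP (sumP ps) m ≡ ΣZ.⨁ (λ p → coeffP p m) ps
coeffP-sumP [] zero = refl
coeffP-sumP [] (suc m) = refl
coeffP-sumP (p ∷ ps) m = trans (coeffP-⊕ p (sumP ps) m) (cong (λ z → coeffP p m ℤ.+ z) (coeffP-sumP ps m))

admissibleᵇ : Filling → Bool
admissibleᵇ F = nonAttacking F ∧ (maj F ≡ᵇ 0)

hasWeight : ℕ → (ℕ → ℕ) → Filling → Bool
hasWeight n w F = all (λ l → weight F l ≡ᵇ w l) (map suc (upTo n))

contribution : ℕ → (ℕ → ℕ) → ℕ → Filling → ℤ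
contribution n w m F = if admissibleᵇ F then (if hasWeight n w F then coeffP (contrib F) m else ℤ.0ℤ) else ℤ.0ℤ

shapeSum : ℕ → List ℕ → (List ℕ → ℤ) → ℤ
shapeSum n α G = ΣZ.⨁ (λ γ → if eqListᵇ (delZeros γ) α then G γ else ℤ.0ℤ) (listsOver n (upTo (suc (sum α))))

coefficient-as-sum : ∀ n α w m →
  coeffP (LCoeff n α w) m ≡ shapeSum n α (λ γ → ΣZ.⨁ (contribution n w m) (fillingsOfShape n γ))
coefficient-as-sum n α w m = begin
    coeffP (LCoeff n α w) m
  ≡⟨ coeffP-sumP (map contrib (filterᵇ (hasWeight n w) (admissible n α))) m ⟩
    ⨁ (λ p → coeffP p m) (map contrib (filterᵇ (hasWeight n w) (admissible n α)))
  ≡⟨ ⨁-map (λ p → coeffP p m) contrib (filterᵇ (hasWeight n w) (admissible n α)) ⟩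
    ⨁ (λ F → coeffP (contrib F) m) (filterᵇ (hasWeight n w) (filterᵇ admissibleᵇ allFillings))
  ≡⟨ ⨁-filter (λ F → coeffP (contrib F) m) (hasWeight n w) (filterᵇ admissibleᵇ allFillings) ⟩
    ⨁ (λ F → if hasWeight n w F then coeffP (contrib F) m else ℤ.0ℤ) (filterᵇ admissibleᵇ allFillings)
  ≡⟨ ⨁-filter (λ F → if hasWeight n w F then coeffP (contrib F) m else ℤ.0ℤ) admissibleᵇ allFillings ⟩
    ⨁ (contribution n w m) allFillings
  ≡⟨ ⨁-concatMap (contribution n w m) (fillingsOfShape n) (weakComps n α) ⟩
    ⨁ (λ γ → ⨁ (contribution n w m) (fillingsOfShape n γ)) (weakComps n α)
  ≡⟨ ⨁-filter (λ γ → ⨁ (contribution n w m) (fillingsOfShape n γ)) (λ γ → eqListᵇ (delZeros γ) α)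
               (listsOver n (upTo (suc (sum α)))) ⟩
    shapeSum n α (λ γ → ⨁ (contribution n w m) (fillingsOfShape n γ))
  ∎ where
  open ≡-Reasoning
  open ΣZ
  allFillings = concatMap (fillingsOfShape n) (weakComps n α)

admissible-split : ∀ F → admissibleᵇ F ≡ true → nonAttacking F ≡ true × maj F ≡ 0
admissible-split F e with nonAttacking F | maj F ≡ᵇ 0 in eq
admissible-split F refl | true | true = refl , NP.≡ᵇ⇒≡ _ 0 (true⇒T eq)

hasWeight-at : ∀ n w F → hasWeight n w F ≡ true → ∀ j → 1 ≤ j → j ≤ n → weight F j ≡ w j
hasWeight-at n w F e (suc x) _ j≤n = NP.≡ᵇ⇒≡ _ _ (true⇒T
  (ΣB.Conical.⨁<-vanishing ∧-conical n (λ x → weight F (suc x) ≡ᵇ w (suc x))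
     (trans (sym (ΣB.⨁-map _ suc (upTo n))) (trans (sym (and-⨁ _ (map suc (upTo n)))) e)) x j≤n))

contribution-wrong-weight : ∀ n w m F → hasWeight n w F ≡ false → contribution n w m F ≡ ℤ.0ℤ
contribution-wrong-weight n w m F e rewrite e with admissibleᵇ F
... | true = refl
... | false = refl

contribution-row-empty : ∀ n w m F → length F ≡ n → FirstColumnPositive F → ∀ j → 1 ≤ j → j ≤ n → w j ≡ 0 →
  contribution n w m F ≡ (if rowLen F j ≡ᵇ 0 then contribution n w m F else ℤ.0ℤ)
contribution-row-empty n w m F len≡n positive j 1≤j j≤n w≡0 with rowLen F j ≡ᵇ 0 in eq
... | true = refl
... | false with admissibleᵇ F in adm
...   | false = refl
...   | true with hasWeight n w F in hw
...     | false = refl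
...     | true = ⊥-elim (subst T eq (NP.≡⇒≡ᵇ _ 0 (row-empty-if-absent F (proj₁ split) (proj₂ split) positive j 1≤j
                   (subst (j ≤_) (sym len≡n) j≤n) (trans (hasWeight-at n w F hw j 1≤j j≤n) w≡0))))
  where split = admissible-split F adm

hasWeight-σ : ∀ n w t F → suc t < length F → length F ≡ n →
  hasWeight n (λ x → w (transp (suc t) x)) (σ t F) ≡ hasWeight n w F
hasWeight-σ n w t F bound len≡n = begin
    and (map (λ j → weight (σ t F) j ≡ᵇ w (transp (suc t) j)) (map suc (upTo n)))
  ≡⟨ and-⨁ _ (map suc (upTo n)) ⟩
    ΣB.⨁ (λ j → weight (σ t F) j ≡ᵇ w (transp (suc t) j)) (map suc (upTo n))
  ≡⟨ ΣB.⨁-cong (λ j → cong (_≡ᵇ w (transp (suc t) j)) (weight-σ t F bound j)) (map suc (upTo n)) ⟩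
    ΣB.⨁ (λ j → weight F (transp (suc t) j) ≡ᵇ w (transp (suc t) j)) (map suc (upTo n))
  ≡⟨ ΣB.⨁-rows-transp n t (λ j → weight F j ≡ᵇ w j) (subst (suc t <_) len≡n bound) ⟩
    ΣB.⨁ (λ j → weight F j ≡ᵇ w j) (map suc (upTo n))
  ≡⟨ sym (and-⨁ _ (map suc (upTo n))) ⟩
    hasWeight n w F
  ∎ where open ≡-Reasoning

admissible-σ : ∀ t F → Vacant t F → admissibleᵇ (σ t F) ≡ admissibleᵇ F
admissible-σ t F H = cong₂ _∧_ (VacantFilling.nonAttacking-σ t F H) (cong (_≡ᵇ 0) (VacantFilling.maj-σ t F H))

contrib-σ : ∀ t F → (H : Vacant t F) →
  (∀ r → 1 ≤ r → r ≤ length F → 0 < rowLen F r → val F (r , 1) ≡ r) → contrib (σ t F) ≡ contrib F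
contrib-σ t F H first-column =
  cong₂ _⊗_ (cong tPow (CoinvInvariance.coinv-σ t F H first-column)) (cong oneMinusTPow (VacantFilling.nDiff-σ t F H))

contribution-σ-vacant : ∀ n w m t F → Vacant t F → length F ≡ n → FirstColumnPositive F →
  contribution n w m F ≡ contribution n (λ x → w (transp (suc t) x)) m (σ t F)
contribution-σ-vacant n w m t F H len≡n positive
  rewrite admissible-σ t F H | hasWeight-σ n w t F (Vacant.bound H) len≡n with admissibleᵇ F in adm
... | false = refl
... | true with hasWeight n w F
...   | false = refl
...   | true = cong (λ p → coeffP p m)
        (sym (contrib-σ t F H (first-column-identity F (proj₁ (admissible-split F adm)) (proj₂ (admissible-split F adm)) positive)))

-- The swap lemma for a single filling with an empty row l+1: F and σ t F
-- contribute equally to the coefficients of x^w and x^(w ∘ sₗ).  (If some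
-- cell holds l+1, neither has the right weight.)
contribution-σ : ∀ n w m t F → length F ≡ n → FirstColumnPositive F → suc t < n → w (suc (suc t)) ≡ 0 →
  rowLen F (suc (suc t)) ≡ 0 → contribution n w m F ≡ contribution n (λ x → w (transp (suc t) x)) m (σ t F)
contribution-σ n w m t F len≡n positive t+1<n w≡0 row-empty with weight F (suc (suc t)) NP.≟ 0
... | yes weight≡0 = contribution-σ-vacant n w m t F
        (record { bound = bound ; row-empty = row-empty ; value-absent = weight≡0 }) len≡n positive
  where bound = subst (suc t <_) (sym len≡n) t+1<n
... | no weight≢0 = trans (contribution-wrong-weight n w m F wrong) (sym (contribution-wrong-weight n _ m (σ t F) wrongσ))
  where
  wrong : hasWeight n w F ≡ false
  wrong = ¬T⇒false (λ h → weight≢0 (trans (hasWeight-at n w F (T⇒true h) (suc (suc t)) (s≤s z≤n) t+1<n) w≡0))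
  wrongσ : hasWeight n (λ x → w (transp (suc t) x)) (σ t F) ≡ false
  wrongσ = trans (hasWeight-σ n w t F (subst (suc t <_) (sym len≡n) t+1<n) len≡n) wrong

listsOver-all : {P : ℕ → Set} (g : ℕ) (xs : List ℕ) → All P xs →
  All (λ r → length r ≡ g × All P r) (listsOver g xs)
listsOver-all zero xs all-xs = (refl , []) ∷ []
listsOver-all (suc g) xs all-xs = AllP.concat⁺ (AllP.map⁺ (All.map
  (λ px → AllP.map⁺ (All.map (λ { (len , all-r) → cong suc len , px ∷ all-r }) (listsOver-all g xs all-xs)))
  all-xs))

ShapedFilling : List ℕ → Filling → Set
ShapedFilling γ F = (map length F ≡ γ) × All (All (1 ≤_)) F

positive-range : ∀ n → All (1 ≤_) (map suc (upTo n))
positive-range n = AllP.map⁺ (All.universal (λ _ → s≤s z≤n) (upTo n))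

fillingsOfShape-all : ∀ n γ → All (ShapedFilling γ) (fillingsOfShape n γ)
fillingsOfShape-all n [] = (refl , []) ∷ []
fillingsOfShape-all n (g ∷ γ) = AllP.concat⁺ (AllP.map⁺ (All.map
  (λ { (len , all-r) → AllP.map⁺ (All.map (λ { (shape , pos) → cong₂ _∷_ len shape , all-r ∷ pos })
                                          (fillingsOfShape-all n γ)) })
  (listsOver-all g (map suc (upTo n)) (positive-range n))))

length-shaped : ∀ {n γ F} → length γ ≡ n → ShapedFilling γ F → length F ≡ n
length-shaped {n} {γ} {F} len-γ (shape , _) = trans (sym (LP.length-map length F)) (trans (cong length shape) len-γ)

first-column-positive : ∀ F → All (All (1 ≤_)) F → FirstColumnPositive F
first-column-positive (r ∷ F) (pos-r ∷ pos) (suc zero) _ _ 0<R = first pos-r 0<R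
  where
  first : ∀ {r} → All (1 ≤_) r → 0 < length r → 1 ≤ fromMaybe 0 (nth r 0)
  first (p ∷ _) _ = p
first-column-positive (r ∷ F) (_ ∷ pos) (suc (suc i)) _ (s≤s i≤N) 0<R =
  first-column-positive F pos (suc i) (s≤s z≤n) i≤N 0<R

rowLen-shape : (F : Filling) → ∀ i → rowLen F (suc i) ≡ fromMaybe 0 (nth (map length F) i)
rowLen-shape [] i = refl
rowLen-shape (r ∷ F) zero = refl
rowLen-shape (r ∷ F) (suc i) = rowLen-shape F i

⨁-listsOver-suc : (H : List ℕ → ℤ) (g : ℕ) (xs : List ℕ) →
  ΣZ.⨁ H (listsOver (suc g) xs) ≡ ΣZ.⨁ (λ x → ΣZ.⨁ (λ ρ → H (x ∷ ρ)) (listsOver g xs)) xs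
⨁-listsOver-suc H g xs = trans (ΣZ.⨁-concatMap H _ xs) (ΣZ.⨁-cong (λ x → ΣZ.⨁-map H (x ∷_) (listsOver g xs)) xs)

⨁-listsOver-swapAdjacent : (h : List ℕ → ℤ) (xs : List ℕ) (p n : ℕ) → suc p < n →
  ΣZ.⨁ (λ γ → h (swapAdjacent p γ)) (listsOver n xs) ≡ ΣZ.⨁ h (listsOver n xs)
⨁-listsOver-swapAdjacent h xs zero (suc zero) (s≤s ())
⨁-listsOver-swapAdjacent h xs zero (suc (suc g)) _ = begin
    ⨁ (λ γ → h (swapAdjacent 0 γ)) (listsOver (suc (suc g)) xs)
  ≡⟨ ⨁-listsOver-suc _ (suc g) xs ⟩
    ⨁ (λ x → ⨁ (λ ρ → h (swapAdjacent 0 (x ∷ ρ))) (listsOver (suc g) xs)) xs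
  ≡⟨ ⨁-cong (λ x → ⨁-listsOver-suc _ g xs) xs ⟩
    ⨁ (λ x → ⨁ (λ y → ⨁ (λ ρ → h (y ∷ x ∷ ρ)) (listsOver g xs)) xs) xs
  ≡⟨ ⨁-comm (λ x y → ⨁ (λ ρ → h (y ∷ x ∷ ρ)) (listsOver g xs)) xs xs ⟩
    ⨁ (λ y → ⨁ (λ x → ⨁ (λ ρ → h (y ∷ x ∷ ρ)) (listsOver g xs)) xs) xs
  ≡⟨ ⨁-cong (λ y → sym (⨁-listsOver-suc _ g xs)) xs ⟩
    ⨁ (λ y → ⨁ (λ ρ → h (y ∷ ρ)) (listsOver (suc g) xs)) xs
  ≡⟨ sym (⨁-listsOver-suc h (suc g) xs) ⟩
    ⨁ h (listsOver (suc (suc g)) xs)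
  ∎ where open ≡-Reasoning ; open ΣZ
⨁-listsOver-swapAdjacent h xs (suc p) (suc g) (s≤s p+1<g) = begin
    ⨁ (λ γ → h (swapAdjacent (suc p) γ)) (listsOver (suc g) xs)
  ≡⟨ ⨁-listsOver-suc _ g xs ⟩
    ⨁ (λ x → ⨁ (λ ρ → h (x ∷ swapAdjacent p ρ)) (listsOver g xs)) xs
  ≡⟨ ⨁-cong (λ x → ⨁-listsOver-swapAdjacent (λ ρ → h (x ∷ ρ)) xs p g p+1<g) xs ⟩
    ⨁ (λ x → ⨁ (λ ρ → h (x ∷ ρ)) (listsOver g xs)) xs
  ≡⟨ sym (⨁-listsOver-suc h g xs) ⟩
    ⨁ h (listsOver (suc g) xs)
  ∎ where open ≡-Reasoning ; open ΣZ

module Reindex (n t : ℕ) (t+1<n : suc t < n) where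
  open ΣZ
  l = suc t
  entries = map suc (upTo n)

  ⨁-listsOver-relabel : (h : List ℕ → ℤ) (g : ℕ) →
    ⨁ (λ r → h (map (transp l) r)) (listsOver g entries) ≡ ⨁ h (listsOver g entries)
  ⨁-listsOver-relabel h zero = refl
  ⨁-listsOver-relabel h (suc g) = begin
      ⨁ (λ r → h (map (transp l) r)) (listsOver (suc g) entries)
    ≡⟨ ⨁-listsOver-suc _ g entries ⟩
      ⨁ (λ x → ⨁ (λ ρ → h (transp l x ∷ map (transp l) ρ)) (listsOver g entries)) entries
    ≡⟨ ⨁-cong (λ x → ⨁-listsOver-relabel (λ ρ → h (transp l x ∷ ρ)) g) entries ⟩
      ⨁ (λ x → ⨁ (λ ρ → h (transp l x ∷ ρ)) (listsOver g entries)) entries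
    ≡⟨ ⨁-rows-transp n t (λ x → ⨁ (λ ρ → h (x ∷ ρ)) (listsOver g entries)) t+1<n ⟩
      ⨁ (λ x → ⨁ (λ ρ → h (x ∷ ρ)) (listsOver g entries)) entries
    ≡⟨ sym (⨁-listsOver-suc h g entries) ⟩
      ⨁ h (listsOver (suc g) entries)
    ∎ where open ≡-Reasoning

  ⨁-fillingsOfShape-cons : (H : Filling → ℤ) (g : ℕ) (γ : List ℕ) →
    ⨁ H (fillingsOfShape n (g ∷ γ)) ≡ ⨁ (λ r → ⨁ (λ Q → H (r ∷ Q)) (fillingsOfShape n γ)) (listsOver g entries)
  ⨁-fillingsOfShape-cons H g γ =
    trans (⨁-concatMap H _ (listsOver g entries)) (⨁-cong (λ r → ⨁-map H (r ∷_) (fillingsOfShape n γ)) (listsOver g entries))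

  ⨁-fillings-relabel : (h : Filling → ℤ) (γ : List ℕ) →
    ⨁ (λ F → h (map (map (transp l)) F)) (fillingsOfShape n γ) ≡ ⨁ h (fillingsOfShape n γ)
  ⨁-fillings-relabel h [] = refl
  ⨁-fillings-relabel h (g ∷ γ) = begin
      ⨁ (λ F → h (map (map (transp l)) F)) (fillingsOfShape n (g ∷ γ))
    ≡⟨ ⨁-fillingsOfShape-cons _ g γ ⟩
      ⨁ (λ r → ⨁ (λ Q → h (map (transp l) r ∷ map (map (transp l)) Q)) (fillingsOfShape n γ)) (listsOver g entries)
    ≡⟨ ⨁-cong (λ r → ⨁-fillings-relabel (λ Q → h (map (transp l) r ∷ Q)) γ) (listsOver g entries) ⟩
      ⨁ (λ r → ⨁ (λ Q → h (map (transp l) r ∷ Q)) (fillingsOfShape n γ)) (listsOver g entries)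
    ≡⟨ ⨁-listsOver-relabel (λ r → ⨁ (λ Q → h (r ∷ Q)) (fillingsOfShape n γ)) g ⟩
      ⨁ (λ r → ⨁ (λ Q → h (r ∷ Q)) (fillingsOfShape n γ)) (listsOver g entries)
    ≡⟨ sym (⨁-fillingsOfShape-cons h g γ) ⟩
      ⨁ h (fillingsOfShape n (g ∷ γ))
    ∎ where open ≡-Reasoning

  ⨁-fillings-σ : (h : Filling → ℤ) (s : ℕ) (γ : List ℕ) →
    ⨁ (λ F → h (map (map (transp l)) (swapAdjacent s F))) (fillingsOfShape n γ) ≡ ⨁ h (fillingsOfShape n (swapAdjacent s γ))
  ⨁-fillings-σ h zero [] = refl
  ⨁-fillings-σ h zero (g ∷ []) = trans (⨁-fillingsOfShape-cons _ g [])
    (trans (⨁-listsOver-relabel (λ r → h (r ∷ []) ℤ.+ ℤ.0ℤ) g) (sym (⨁-fillingsOfShape-cons h g [])))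
  ⨁-fillings-σ h zero (g₁ ∷ g₂ ∷ γ) = begin
      ⨁ (λ F → h (map (map (transp l)) (swapAdjacent 0 F))) (fillingsOfShape n (g₁ ∷ g₂ ∷ γ))
    ≡⟨ trans (⨁-fillingsOfShape-cons _ g₁ (g₂ ∷ γ)) (⨁-cong (λ r₁ → ⨁-fillingsOfShape-cons _ g₂ γ) (listsOver g₁ entries)) ⟩
      ⨁ (λ r₁ → ⨁ (λ r₂ → ⨁ (λ Q → h (map (transp l) r₂ ∷ map (transp l) r₁ ∷ map (map (transp l)) Q))
                                (fillingsOfShape n γ)) (listsOver g₂ entries)) (listsOver g₁ entries)
    ≡⟨ ⨁-cong (λ r₁ → ⨁-cong (λ r₂ → ⨁-fillings-relabel (λ Q → h (map (transp l) r₂ ∷ map (transp l) r₁ ∷ Q)) γ)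
                             (listsOver g₂ entries)) (listsOver g₁ entries) ⟩
      ⨁ (λ r₁ → ⨁ (λ r₂ → ⨁ (λ Q → h (map (transp l) r₂ ∷ map (transp l) r₁ ∷ Q))
                                (fillingsOfShape n γ)) (listsOver g₂ entries)) (listsOver g₁ entries)
    ≡⟨ ⨁-cong (λ r₁ → ⨁-listsOver-relabel (λ r₂ → ⨁ (λ Q → h (r₂ ∷ map (transp l) r₁ ∷ Q)) (fillingsOfShape n γ)) g₂)
              (listsOver g₁ entries) ⟩
      ⨁ (λ r₁ → ⨁ (λ r₂ → ⨁ (λ Q → h (r₂ ∷ map (transp l) r₁ ∷ Q)) (fillingsOfShape n γ)) (listsOver g₂ entries))
        (listsOver g₁ entries)
    ≡⟨ ⨁-listsOver-relabel (λ r₁ → ⨁ (λ r₂ → ⨁ (λ Q → h (r₂ ∷ r₁ ∷ Q)) (fillingsOfShape n γ)) (listsOver g₂ entries)) g₁ ⟩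
      ⨁ (λ r₁ → ⨁ (λ r₂ → ⨁ (λ Q → h (r₂ ∷ r₁ ∷ Q)) (fillingsOfShape n γ)) (listsOver g₂ entries)) (listsOver g₁ entries)
    ≡⟨ ⨁-comm (λ r₁ r₂ → ⨁ (λ Q → h (r₂ ∷ r₁ ∷ Q)) (fillingsOfShape n γ)) (listsOver g₁ entries) (listsOver g₂ entries) ⟩
      ⨁ (λ r₂ → ⨁ (λ r₁ → ⨁ (λ Q → h (r₂ ∷ r₁ ∷ Q)) (fillingsOfShape n γ)) (listsOver g₁ entries)) (listsOver g₂ entries)
    ≡⟨ sym (trans (⨁-fillingsOfShape-cons h g₂ (g₁ ∷ γ)) (⨁-cong (λ r₂ → ⨁-fillingsOfShape-cons _ g₁ γ) (listsOver g₂ entries))) ⟩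
      ⨁ h (fillingsOfShape n (g₂ ∷ g₁ ∷ γ))
    ∎ where open ≡-Reasoning
  ⨁-fillings-σ h (suc s) [] = refl
  ⨁-fillings-σ h (suc s) (g ∷ γ) = begin
      ⨁ (λ F → h (map (map (transp l)) (swapAdjacent (suc s) F))) (fillingsOfShape n (g ∷ γ))
    ≡⟨ ⨁-fillingsOfShape-cons _ g γ ⟩
      ⨁ (λ r → ⨁ (λ Q → h (map (transp l) r ∷ map (map (transp l)) (swapAdjacent s Q))) (fillingsOfShape n γ))
        (listsOver g entries)
    ≡⟨ ⨁-cong (λ r → ⨁-fillings-σ (λ Q → h (map (transp l) r ∷ Q)) s γ) (listsOver g entries) ⟩
      ⨁ (λ r → ⨁ (λ Q → h (map (transp l) r ∷ Q)) (fillingsOfShape n (swapAdjacent s γ))) (listsOver g entries)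
    ≡⟨ ⨁-listsOver-relabel (λ r → ⨁ (λ Q → h (r ∷ Q)) (fillingsOfShape n (swapAdjacent s γ))) g ⟩
      ⨁ (λ r → ⨁ (λ Q → h (r ∷ Q)) (fillingsOfShape n (swapAdjacent s γ))) (listsOver g entries)
    ≡⟨ sym (⨁-fillingsOfShape-cons h g (swapAdjacent s γ)) ⟩
      ⨁ h (fillingsOfShape n (swapAdjacent (suc s) (g ∷ γ)))
    ∎ where open ≡-Reasoning

delZeros-swapAdjacent : ∀ p γ → fromMaybe 0 (nth γ (suc p)) ≡ 0 → delZeros (swapAdjacent p γ) ≡ delZeros γ
delZeros-swapAdjacent zero [] e = refl
delZeros-swapAdjacent zero (x ∷ []) e = refl
delZeros-swapAdjacent zero (zero ∷ .zero ∷ γ) refl = refl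
delZeros-swapAdjacent zero (suc x ∷ .zero ∷ γ) refl = refl
delZeros-swapAdjacent (suc p) [] e = refl
delZeros-swapAdjacent (suc p) (zero ∷ γ) e = delZeros-swapAdjacent p γ e
delZeros-swapAdjacent (suc p) (suc x ∷ γ) e = cong (suc x ∷_) (delZeros-swapAdjacent p γ e)

coefficient : ℕ → List ℕ → ℕ → (ℕ → ℕ) → ℤ
coefficient n α m w = coeffP (LCoeff n α w) m

filterᵇ-cong : {A : Set} {p q : A → Bool} → (∀ x → p x ≡ q x) → ∀ xs → filterᵇ p xs ≡ filterᵇ q xs
filterᵇ-cong eq [] = refl
filterᵇ-cong {p = p} {q} eq (x ∷ xs) rewrite eq x with q x
... | true = cong (x ∷_) (filterᵇ-cong eq xs)
... | false = filterᵇ-cong eq xs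

coefficient-cong : ∀ n α m {w₁ w₂ : ℕ → ℕ} → (∀ x → w₁ x ≡ w₂ x) → coefficient n α m w₁ ≡ coefficient n α m w₂
coefficient-cong n α m eq = cong (λ Fs → coeffP (sumP (map contrib Fs)) m)
  (filterᵇ-cong (λ F → cong and (LP.map-cong (λ l → cong (weight F l ≡ᵇ_) (eq l)) (map suc (upTo n)))) (admissible n α))

module SwapLemma (n : ℕ) (α : List ℕ) (m : ℕ) (w : ℕ → ℕ) (t : ℕ) (t+1<n : suc t < n) (w≡0 : w (suc (suc t)) ≡ 0) where
  open ΣZ
  l = suc t

  w' : ℕ → ℕ
  w' x = w (transp l x)

  shapes : List (List ℕ)
  shapes = listsOver n (upTo (suc (sum α)))

  shapes-all : All (λ γ → length γ ≡ n × All (λ _ → ⊤) γ) shapes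
  shapes-all = listsOver-all n (upTo (suc (sum α))) (All.universal (λ _ → tt) (upTo (suc (sum α))))

  δ : List ℕ → Bool
  δ γ = eqListᵇ (delZeros γ) α

  restricted : (ℕ → ℕ) → ℕ → Filling → ℤ
  restricted v j F = if rowLen F j ≡ᵇ 0 then contribution n v m F else ℤ.0ℤ

  G : List ℕ → ℤ
  G γ = ⨁ (restricted w' l) (fillingsOfShape n γ)

  on-fillings : {f g : Filling → ℤ} → (∀ F → length F ≡ n → FirstColumnPositive F → f F ≡ g F) →
    shapeSum n α (λ γ → ⨁ f (fillingsOfShape n γ)) ≡ shapeSum n α (λ γ → ⨁ g (fillingsOfShape n γ))
  on-fillings eq = ⨁-congAll shapes-all (λ γ p → cong (λ z → if δ γ then z else ℤ.0ℤ)
    (⨁-congAll (fillingsOfShape-all n γ) (λ F shaped →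
      eq F (length-shaped (proj₁ p) shaped) (first-column-positive F (proj₂ shaped)))))

  -- Row l+1 of F is row l of σ t F.
  restricted-σ : ∀ F → length F ≡ n → FirstColumnPositive F → restricted w (suc l) F ≡ restricted w' l (σ t F)
  restricted-σ F len pos rewrite rowLen-σ t F (subst (suc t <_) (sym len) t+1<n) l | transp-p l
    with rowLen F (suc l) ≡ᵇ 0 in eq
  ... | false = refl
  ... | true = contribution-σ n w m t F len pos t+1<n w≡0 (NP.≡ᵇ⇒≡ _ 0 (true⇒T eq))

  -- A shape whose part l+1 is nonzero has no filling with an empty row l
  -- after the exchange; otherwise the exchange keeps α(γ).
  swapped-shape : ∀ γ → length γ ≡ n → (if δ γ then G (swapAdjacent t γ) else ℤ.0ℤ)
                                      ≡ (if δ (swapAdjacent t γ) then G (swapAdjacent t γ) else ℤ.0ℤ)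
  swapped-shape γ len with fromMaybe 0 (nth γ (suc t)) NP.≟ 0
  ... | yes zero-part rewrite delZeros-swapAdjacent t γ zero-part = refl
  ... | no nonzero-part = guards-irrelevant (δ γ) (δ (swapAdjacent t γ)) G-vanishes
    where
    guards-irrelevant : ∀ b b' {x} → x ≡ ℤ.0ℤ → (if b then x else ℤ.0ℤ) ≡ (if b' then x else ℤ.0ℤ)
    guards-irrelevant true true _ = refl
    guards-irrelevant true false x≡0 = x≡0
    guards-irrelevant false true x≡0 = sym x≡0
    guards-irrelevant false false _ = refl
    G-vanishes : G (swapAdjacent t γ) ≡ ℤ.0ℤ
    G-vanishes = trans (⨁-congAll (fillingsOfShape-all n (swapAdjacent t γ)) row-l-nonempty)
                       (⨁-unit (fillingsOfShape n (swapAdjacent t γ)))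
      where
      row-l-nonempty : ∀ F → ShapedFilling (swapAdjacent t γ) F → restricted w' l F ≡ ℤ.0ℤ
      row-l-nonempty F (shape , _) rewrite rowLen-shape F t | shape
        | nth-swapAdjacent t γ (subst (suc t <_) (sym len) t+1<n) t | transp-p t | ≢⇒≡ᵇ-false nonzero-part = refl

-- Only
-- fillings with empty row l+1 contribute to C(w); σ maps them to the fillings
-- with empty row l contributing to C(w ∘ sₗ), reindexing shapes and fillings.
swap-lemma : ∀ n α m (w : ℕ → ℕ) t → suc t < n → w (suc (suc t)) ≡ 0 →
  coefficient n α m w ≡ coefficient n α m (λ x → w (transp (suc t) x))
swap-lemma n α m w t t+1<n w≡0 = begin
    coefficient n α m w
  ≡⟨ coefficient-as-sum n α w m ⟩
    shapeSum n α (λ γ → ⨁ (contribution n w m) (fillingsOfShape n γ))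
  ≡⟨ on-fillings (λ F len pos → trans (contribution-row-empty n w m F len pos (suc l) (s≤s z≤n) t+1<n w≡0)
                                      (restricted-σ F len pos)) ⟩
    shapeSum n α (λ γ → ⨁ (λ F → restricted w' l (σ t F)) (fillingsOfShape n γ))
  ≡⟨ ⨁-cong (λ γ → cong (λ z → if δ γ then z else ℤ.0ℤ) (Reindex.⨁-fillings-σ n t t+1<n (restricted w' l) t γ)) shapes ⟩
    ⨁ (λ γ → if δ γ then G (swapAdjacent t γ) else ℤ.0ℤ) shapes
  ≡⟨ ⨁-congAll shapes-all (λ γ p → swapped-shape γ (proj₁ p)) ⟩
    ⨁ (λ γ → if δ (swapAdjacent t γ) then G (swapAdjacent t γ) else ℤ.0ℤ) shapes
  ≡⟨ ⨁-listsOver-swapAdjacent (λ γ → if δ γ then G γ else ℤ.0ℤ) (upTo (suc (sum α))) t n t+1<n ⟩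
    shapeSum n α G
  ≡⟨ on-fillings (λ F len pos → sym (contribution-row-empty n w' m F len pos l (s≤s z≤n) (NP.<⇒≤ t+1<n)
                                       (trans (cong w (transp-p l)) w≡0))) ⟩
    shapeSum n α (λ γ → ⨁ (contribution n w' m) (fillingsOfShape n γ))
  ≡⟨ sym (coefficient-as-sum n α w' m) ⟩
    coefficient n α m w'
  ∎ where
  open ≡-Reasoning
  open ΣZ
  open SwapLemma n α m w t t+1<n w≡0

consecutive : ℕ → ℕ → List ℕ
consecutive s zero = []
consecutive s (suc k) = s ∷ consecutive (suc s) k

monoExp-beyond : ∀ (a is : List ℕ) y → All (y <_) is → monoExp a is y ≡ 0
monoExp-beyond [] is y _ = refl
monoExp-beyond (a ∷ as) [] y _ = refl
monoExp-beyond (a ∷ as) (i ∷ is) y (y<i ∷ y<is)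
  rewrite ≢⇒≡ᵇ-false {i} {y} (λ e → NP.<-irrefl (sym e) y<i) = monoExp-beyond as is y y<is

monoExp-transp : ∀ (a is : List ℕ) p x → All (suc p <_) is → monoExp a is (transp p x) ≡ monoExp a is x
monoExp-transp [] is p x _ = refl
monoExp-transp (a ∷ as) [] p x _ = refl
monoExp-transp (a ∷ as) (i ∷ is) p x (p+1<i ∷ p+1<is) =
  cong₂ _+_ (cong (λ b → if b then a else 0) same-position) (monoExp-transp as is p x p+1<is)
  where
  same-position : (i ≡ᵇ transp p x) ≡ (i ≡ᵇ x)
  same-position = trans (cong (_≡ᵇ transp p x) (sym (transp-elsewhere (λ e → NP.<-irrefl (sym e) (NP.<-trans (NP.n<1+n p) p+1<i))
                                                                       (λ e → NP.<-irrefl (sym e) p+1<i))))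
                        (transp-≡ᵇ p i x)

transp-supported : ∀ (f : ℕ → ℕ) b p x → (∀ y → b < y → f y ≡ 0) → b < p → f (transp p x) ≡ f x
transp-supported f b p x support b<p with position p x
... | at-p refl rewrite transp-p p = trans (support (suc p) (NP.<-trans b<p (NP.n<1+n p))) (sym (support p b<p))
... | at-1+p refl rewrite transp-1+p p = trans (support p b<p) (sym (support (suc p) (NP.<-trans b<p (NP.n<1+n p))))
... | elsewhere e₁ e₂ rewrite transp-elsewhere e₁ e₂ = refl

All-<-weaken : ∀ {a b} {is : List ℕ} → a ≤ b → All (b <_) is → All (a <_) is
All-<-weaken a≤b = All.map (NP.≤-<-trans a≤b)

module Slide (n : ℕ) (α : List ℕ) (m : ℕ) (f : ℕ → ℕ) (b : ℕ) (support : ∀ y → b < y → f y ≡ 0)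
  (a₀ : ℕ) (a' is' : List ℕ) where

  exponents : ℕ → ℕ → ℕ
  exponents p x = f x + ((if p ≡ᵇ x then a₀ else 0) + monoExp a' is' x)

  slide-step : ∀ p → b < p → suc p ≤ n → All (suc p <_) is' →
    coefficient n α m (exponents p) ≡ coefficient n α m (exponents (suc p))
  slide-step (suc t) b<p p+1≤n p+1<is' = trans (swap-lemma n α m (exponents (suc t)) t p+1≤n vacant)
                                               (coefficient-cong n α m moved)
    where
    p = suc t
    vacant : exponents p (suc p) ≡ 0
    vacant rewrite support (suc p) (NP.<-trans b<p (NP.n<1+n p)) | ≢⇒≡ᵇ-false {p} {suc p} (λ e → NP.<-irrefl e (NP.n<1+n p))
      | monoExp-beyond a' is' (suc p) p+1<is' = refl
    moved : ∀ x → exponents p (transp p x) ≡ exponents (suc p) x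
    moved x rewrite transp-supported f b p x support b<p | monoExp-transp a' is' p x p+1<is' =
      cong (λ z → f x + ((if z then a₀ else 0) + monoExp a' is' x))
        (trans (cong (_≡ᵇ transp p x) (sym (transp-1+p p))) (transp-≡ᵇ p (suc p) x))

  slide : ∀ d → suc b + d ≤ n → All (suc b + d <_) is' →
    coefficient n α m (exponents (suc b + d)) ≡ coefficient n α m (exponents (suc b))
  slide zero _ _ = cong (λ p → coefficient n α m (exponents p)) (cong suc (NP.+-identityʳ b))
  slide (suc d) p≤n p<is' = begin
      coefficient n α m (exponents (suc b + suc d))
    ≡⟨ cong (λ p → coefficient n α m (exponents p)) (NP.+-suc (suc b) d) ⟩
      coefficient n α m (exponents (suc (suc b + d)))
    ≡⟨ sym (slide-step (suc b + d) (s≤s (NP.m≤m+n b d)) p+1≤n p+1<is') ⟩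
      coefficient n α m (exponents (suc b + d))
    ≡⟨ slide d (NP.<⇒≤ p+1≤n) (All-<-weaken (NP.n≤1+n _) p+1<is') ⟩
      coefficient n α m (exponents (suc b))
    ∎ where
    open ≡-Reasoning
    p+1≤n : suc (suc b + d) ≤ n
    p+1≤n = subst (_≤ n) (cong suc (NP.+-suc b d)) p≤n
    p+1<is' : All (suc (suc b + d) <_) is'
    p+1<is' = subst (λ z → All (z <_) is') (NP.+-suc (suc b) d) p<is'

canonical-positions : ∀ n α m (f : ℕ → ℕ) b → (∀ y → b < y → f y ≡ 0) → (a is : List ℕ) → length is ≡ length a →
  AllPairs _<_ is → All (b <_) is → All (_≤ n) is →
  coefficient n α m (λ x → f x + monoExp a is x) ≡ coefficient n α m (λ x → f x + monoExp a (consecutive (suc b) (length a)) x)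
canonical-positions n α m f b support [] [] _ _ _ _ = refl
canonical-positions n α m f b support (a₀ ∷ a') (i ∷ is') len (i<is' ∷ increasing) (b<i ∷ b<is') (i≤n ∷ is'≤n) = begin
    coefficient n α m (exponents i)
  ≡⟨ cong (λ p → coefficient n α m (exponents p)) (sym i≡b+1+d) ⟩
    coefficient n α m (exponents (suc b + d))
  ≡⟨ slide d (subst (_≤ n) (sym i≡b+1+d) i≤n) (subst (λ z → All (z <_) is') (sym i≡b+1+d) i<is') ⟩
    coefficient n α m (exponents (suc b))
  ≡⟨ coefficient-cong n α m (λ x → sym (NP.+-assoc (f x) _ _)) ⟩
    coefficient n α m (λ x → f' x + monoExp a' is' x)
  ≡⟨ canonical-positions n α m f' (suc b) support' a' is' (NP.suc-injective len) increasing (All-<-weaken b<i i<is') is'≤n ⟩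
    coefficient n α m (λ x → f' x + monoExp a' (consecutive (suc (suc b)) (length a')) x)
  ≡⟨ coefficient-cong n α m (λ x → NP.+-assoc (f x) _ _) ⟩
    coefficient n α m (λ x → f x + monoExp (a₀ ∷ a') (consecutive (suc b) (length (a₀ ∷ a'))) x)
  ∎ where
  open ≡-Reasoning
  open Slide n α m f b support a₀ a' is'
  d = i ∸ suc b
  i≡b+1+d : suc b + d ≡ i
  i≡b+1+d = NP.m+[n∸m]≡n b<i
  -- the exponent a₀ now sits at b+1 and joins the prefix
  f' : ℕ → ℕ
  f' x = f x + (if suc b ≡ᵇ x then a₀ else 0)
  support' : ∀ y → suc b < y → f' y ≡ 0
  support' y b+1<y rewrite support y (NP.<-trans (NP.n<1+n b) b+1<y) | ≢⇒≡ᵇ-false {suc b} {y} (λ e → NP.<-irrefl e b+1<y) = refl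

-- Proposition 7.2: L_α(x₁,…,xₙ;t) is quasisymmetric.  Both coefficients equal
-- the coefficient of x₁^{a₁}⋯x_k^{a_k}.
proposition7p2 : (α : List ℕ) → All (0 <_) α → (n : ℕ) → 1 ≤ n →
    (a is js : List ℕ) → All (0 <_) a →
    length is ≡ length a → length js ≡ length a →
    AllPairs _<_ is → AllPairs _<_ js →
    All (λ i → 1 ≤ i × i ≤ n) is → All (λ j → 1 ≤ j × j ≤ n) js →
    (m : ℕ) → coeffP (LCoeff n α (monoExp a is)) m ≡ coeffP (LCoeff n α (monoExp a js)) m
proposition7p2 α _ n _ a is js _ len-is len-js increasing-is increasing-js range-is range-js m =
  trans (to-canonical is len-is increasing-is range-is) (sym (to-canonical js len-js increasing-js range-js))
  where
  to-canonical : ∀ ks → length ks ≡ length a → AllPairs _<_ ks → All (λ k → 1 ≤ k × k ≤ n) ks →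
    coefficient n α m (monoExp a ks) ≡ coefficient n α m (monoExp a (consecutive 1 (length a)))
  to-canonical ks len increasing range = canonical-positions n α m (λ _ → 0) 0 (λ _ _ → refl) a ks len increasing
    (All.map proj₁ range) (All.map proj₂ range)
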